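{- Let $R=R_1\times\cdots\times R_s$ be a finite commutative ring with $1\neq0$, where each $R_i$ is a finite local ring with maximal ideal $M_i$ of order $m_i$, $|R_1|/m_1\le\cdots\le|R_s|/m_s$, and $|R_i|/m_i\equiv1\pmod4$ for all $i$. Let $R_0$ be a finite local ring with maximal ideal $M_0$ of order $m_0$ with $|R_0|/m_0\equiv3\pmod4$. Then (a) $n_3(\mathcal{G}_{R_0})=\frac16\, m_0|R_0||R_0^\times|(|R_0|/m_0-2)$; (b) $n_3(\mathcal{G}_R)=\frac{1}{6\cdot 8^s}\prod_{i=1}^s\left(m_i|R_i||R_i^\times|(|R_i|/m_i-5)\right)$; (c) $n_3(\mathcal{G}_{R_0\times R})=\frac{1}{6\cdot8^s}\, m_0|R_0||R_0^\times|(|R_0|/m_0-2)\prod_{i=1}^s\left(m_i|R_i||R_i^\times|(|R_i|/m_i-5)\right)$.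
   Context: A local ring is a commutative ring with a unique maximal ideal. For a finite commutative ring $S$, $S^\times$ is its unit group, $Q_S=\{u^2:u\in S^\times\}$, $T_S=Q_S\cup(-Q_S)$, and the quadratic unitary Cayley graph $\mathcal{G}_S$ has vertex set $S$ with $x,y$ adjacent iff $x-y\in T_S$. $n_3(G)$ denotes the number of triangles in a graph $G$. -}

module Defs where

open import Level using (0ℓ)
open import Data.Bool using (Bool; true; false)
open import Data.Nat using (ℕ; suc)
open import Data.Product using (_×_; _,_; Σ)
open import Data.Sum using (_⊎_)
open import Data.List using (List; []; _∷_; _++_; map; length; filter; filterᵇ)
open import Data.List.Relation.Unary.Any using (Any; any?)
open import Data.Vec using (Vec; []; _∷_)
open import Relation.Binary.Definitions using (Decidable)
open import Relation.Binary.PropositionalEquality using (_≡_)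
open import Relation.Nullary using (¬_)
open import Relation.Nullary.Decidable using (_×-dec_; _⊎-dec_)
open import Algebra.Bundles using (CommutativeRing)
import Algebra.Construct.DirectProduct as DP
import Data.List.Relation.Unary.Unique.Setoid as USetoid
open import Algebra.Morphism.Structures using (module RingMorphisms)

record FinCommRing : Set₁ where
  field
    cring    : CommutativeRing 0ℓ 0ℓ
  open CommutativeRing cring public hiding (ring)
  field
    _≈?_     : Decidable _≈_
    elems    : List Carrier
    complete : ∀ x → Any (x ≈_) elems
    unique   : USetoid.Unique setoid elems

module _ (F : FinCommRing) where
  open FinCommRing F

  card : ℕ
  card = length elems

  isUnit? : (x : Carrier) → _
  isUnit? x = any? (λ y → (x * y) ≈? 1#) elems

  unitCard : ℕ
  unitCard = length (filter isUnit? elems)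

  inT? : (x : Carrier) → _
  inT? x = any? (λ u → isUnit? u ×-dec ((x ≈? (u * u)) ⊎-dec (x ≈? (- (u * u))))) elems

  adj? : (x y : Carrier) → _
  adj? x y = inT? (x + (- y))

  Subset : Set
  Subset = Carrier → Bool

  record IsIdeal (I : Subset) : Set where
    field
      resp  : ∀ {x y} → x ≈ y → I x ≡ I y
      zero∈ : I 0# ≡ true
      +-closed : ∀ x y → I x ≡ true → I y ≡ true → I (x + y) ≡ true
      *-closed : ∀ r x → I x ≡ true → I (r * x) ≡ true

  IsMaximalIdeal : Subset → Set
  IsMaximalIdeal I =
    IsIdeal I × I 1# ≡ false ×
    (∀ J → IsIdeal J → (∀ x → I x ≡ true → J x ≡ true) →
       (∀ x → J x ≡ true → I x ≡ true) ⊎ (∀ x → J x ≡ true))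

  IsLocalWithMax : Subset → Set
  IsLocalWithMax M = IsMaximalIdeal M × (∀ N → IsMaximalIdeal N → ∀ x → N x ≡ M x)

  subsetCard : Subset → ℕ
  subsetCard M = length (filterᵇ M elems)

-- Counting triangles: number of 3-element subsets {x,y,z} of the vertex
-- set that are pairwise adjacent (enumerated as x before y before z in
-- the duplicate-free enumeration).

triples : {A : Set} → List A → List (A × A × A)
triples [] = []
triples (x ∷ xs) = pairsWith x xs ++ triples xs
  where
  pairsWith : {A : Set} → A → List A → List (A × A × A)
  pairsWith x [] = []
  pairsWith x (y ∷ ys) = map (λ z → x , y , z) ys ++ pairsWith x ys

n3 : FinCommRing → ℕ
n3 F = length (filter (λ { (x , y , z) → adj? F x y ×-dec (adj? F x z ×-dec adj? F y z) })
                      (triples (FinCommRing.elems F)))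

prodRing : ∀ {k} → Vec (CommutativeRing 0ℓ 0ℓ) (suc k) → CommutativeRing 0ℓ 0ℓ
prodRing (R ∷ []) = R
prodRing (R ∷ S ∷ Rs) = DP.commutativeRing R (prodRing (S ∷ Rs))

_≅_ : CommutativeRing 0ℓ 0ℓ → CommutativeRing 0ℓ 0ℓ → Set
A ≅ B = Σ (CommutativeRing.Carrier A → CommutativeRing.Carrier B)
          (RingMorphisms.IsRingIsomorphism (CommutativeRing.rawRing A) (CommutativeRing.rawRing B))

-- For any finite ring F, the Cayley graph 𝒢_F has adjacency
-- weight τ(x - y), τ the indicator of T_F = Q_F ∪ -Q_F; it is symmetric
-- with zero diagonal, so 6 · n3(𝒢_F) equals the triangle sum
-- Δ τ = Σ_{x,y,z} τ(x-y) τ(x-z) τ(y-z).  Δ is invariant under ring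
-- isomorphisms and multiplicative on separable weights over products; if
-- -1 ∈ Q_B then T_{A×B} = T_A × Q_B.  For a local ring with residue field
-- of odd order q = 2j + 1 we show 2 is a unit, |Q| = j m, and -1 ∈ Q iff
-- q ≡ 1 (mod 4).  For q ≡ 3, T is the unit group and every edge lies in
-- (q - 2) m triangles; for q ≡ 1, T = Q, 1 + M ⊆ Q, and a double count
-- shows every edge lies in (q - 5) m / 4 triangles.  The three parts then
-- follow by computing Δ in the explicit product ring.
module Submission where

module Sums where

  open import Data.Nat using (ℕ; suc; _+_; _*_; _≤_; z≤n; s≤s)
  open import Data.Nat.Properties
  open import Data.List using (List; []; _∷_; _++_; map; length; filter)
  open import Data.List.Relation.Unary.All using (All; []; _∷_)
  open import Data.Product using (_×_; _,_)
  open import Relation.Nullary using (Dec; yes; no; ¬_)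
  open import Relation.Nullary.Decidable using (_×-dec_; _⊎-dec_; ¬?)
  open import Relation.Binary.PropositionalEquality
  open import Data.Empty using (⊥-elim)
  open import Data.Sum using (inj₁; inj₂)
  import Algebra.Properties.CommutativeSemigroup as CSProps
  open import Data.Nat.Tactic.RingSolver using (solve-∀)

  sumL : {A : Set} → List A → (A → ℕ) → ℕ
  sumL [] f = 0
  sumL (x ∷ xs) f = f x + sumL xs f

  χ : {P : Set} → Dec P → ℕ
  χ (yes _) = 1
  χ (no _) = 0

  χ-⇔ : {P Q : Set} → (P → Q) → (Q → P) → (p : Dec P) (q : Dec Q) → χ p ≡ χ q
  χ-⇔ f g (yes p) (yes q) = refl
  χ-⇔ f g (yes p) (no ¬q) = ⊥-elim (¬q (f p))
  χ-⇔ f g (no ¬p) (yes q) = ⊥-elim (¬p (g q))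
  χ-⇔ f g (no ¬p) (no ¬q) = refl

  χ≤1 : {P : Set} (p : Dec P) → χ p ≤ 1
  χ≤1 (yes _) = s≤s z≤n
  χ≤1 (no _) = z≤n

  χ-yes : {P : Set} (p : Dec P) → P → χ p ≡ 1
  χ-yes (yes _) _ = refl
  χ-yes (no ¬p) x = ⊥-elim (¬p x)

  χ-no : {P : Set} (p : Dec P) → ¬ P → χ p ≡ 0
  χ-no (yes x) ¬x = ⊥-elim (¬x x)
  χ-no (no _) _ = refl

  χ-1 : {P : Set} (p : Dec P) → χ p ≡ 1 → P
  χ-1 (yes x) _ = x

  χ-≤ : {P Q : Set} → (P → Q) → (p : Dec P) (q : Dec Q) → χ p ≤ χ q
  χ-≤ f (yes p) (yes q) = s≤s z≤n
  χ-≤ f (yes p) (no ¬q) = ⊥-elim (¬q (f p))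
  χ-≤ f (no _) q = z≤n

  χ-× : {P Q : Set} (p : Dec P) (q : Dec Q) → χ (p ×-dec q) ≡ χ p * χ q
  χ-× (yes p) (yes q) = refl
  χ-× (yes p) (no q) = refl
  χ-× (no p) q = refl

  χ-idem : {P : Set} (p : Dec P) → χ p * χ p ≡ χ p
  χ-idem (yes _) = refl
  χ-idem (no _) = refl

  χ-split : {P Q : Set} (p : Dec P) (q : Dec Q) → χ p ≡ χ (p ×-dec q) + χ (p ×-dec ¬? q)
  χ-split (yes p) (yes q) = refl
  χ-split (yes p) (no q) = refl
  χ-split (no p) q = refl

  χ-⊎ : {P Q : Set} (p : Dec P) (q : Dec Q) → ¬ (P × Q) → χ (p ⊎-dec q) ≡ χ p + χ q
  χ-⊎ (yes p) (yes q) n = ⊥-elim (n (p , q))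
  χ-⊎ (yes p) (no q) n = refl
  χ-⊎ (no p) (yes q) n = refl
  χ-⊎ (no p) (no q) n = refl

  sumL-cong : {A : Set} (xs : List A) {f g : A → ℕ} → (∀ x → f x ≡ g x) → sumL xs f ≡ sumL xs g
  sumL-cong [] e = refl
  sumL-cong (x ∷ xs) e = cong₂ _+_ (e x) (sumL-cong xs e)

  sumL-0 : {A : Set} (xs : List A) → sumL xs (λ _ → 0) ≡ 0
  sumL-0 [] = refl
  sumL-0 (x ∷ xs) = sumL-0 xs

  sumL-+ : {A : Set} (xs : List A) (f g : A → ℕ) → sumL xs (λ x → f x + g x) ≡ sumL xs f + sumL xs g
  sumL-+ [] f g = refl
  sumL-+ (x ∷ xs) f g rewrite sumL-+ xs f g =
    CSProps.interchange +-commutativeSemigroup (f x) (g x) (sumL xs f) (sumL xs g)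

  sumL-*ˡ : {A : Set} (xs : List A) (c : ℕ) (f : A → ℕ) → sumL xs (λ x → c * f x) ≡ c * sumL xs f
  sumL-*ˡ [] c f = sym (*-zeroʳ c)
  sumL-*ˡ (x ∷ xs) c f rewrite sumL-*ˡ xs c f = sym (*-distribˡ-+ c (f x) (sumL xs f))

  sumL-*ʳ : {A : Set} (xs : List A) (c : ℕ) (f : A → ℕ) → sumL xs (λ x → f x * c) ≡ sumL xs f * c
  sumL-*ʳ xs c f = trans (sumL-cong xs (λ x → *-comm (f x) c)) (trans (sumL-*ˡ xs c f) (*-comm c _))

  sumL-swap : {A B : Set} (xs : List A) (ys : List B) (f : A → B → ℕ) →
    sumL xs (λ x → sumL ys (f x)) ≡ sumL ys (λ y → sumL xs (λ x → f x y))
  sumL-swap [] ys f = sym (sumL-0 ys)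
  sumL-swap (x ∷ xs) ys f rewrite sumL-swap xs ys f =
    sym (sumL-+ ys (f x) (λ y → sumL xs (λ x → f x y)))

  sumL-mono : {A : Set} (xs : List A) {f g : A → ℕ} → (∀ x → f x ≤ g x) → sumL xs f ≤ sumL xs g
  sumL-mono [] le = z≤n
  sumL-mono (x ∷ xs) le = +-mono-≤ (le x) (sumL-mono xs le)

  sumL-++ : {A : Set} (xs ys : List A) (f : A → ℕ) → sumL (xs ++ ys) f ≡ sumL xs f + sumL ys f
  sumL-++ [] ys f = refl
  sumL-++ (x ∷ xs) ys f rewrite sumL-++ xs ys f = sym (+-assoc (f x) _ _)

  sumL-map : {A B : Set} (xs : List A) (g : A → B) (f : B → ℕ) → sumL (map g xs) f ≡ sumL xs (λ x → f (g x))
  sumL-map [] g f = refl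
  sumL-map (x ∷ xs) g f = cong (f (g x) +_) (sumL-map xs g f)

  sumL-prod : {A B : Set} (xs : List A) (ys : List B) (f : A → ℕ) (g : B → ℕ) →
    sumL xs (λ x → sumL ys (λ y → f x * g y)) ≡ sumL xs f * sumL ys g
  sumL-prod xs ys f g = trans (sumL-cong xs (λ x → sumL-*ˡ ys (f x) g)) (sumL-*ʳ xs (sumL ys g) f)

  length-filter : {A : Set} {P : A → Set} (P? : ∀ x → Dec (P x)) (xs : List A) →
    length (filter P? xs) ≡ sumL xs (λ x → χ (P? x))
  length-filter P? [] = refl
  length-filter P? (x ∷ xs) with P? x
  ... | yes _ = cong suc (length-filter P? xs)
  ... | no _ = length-filter P? xs

  length-sum : {A : Set} (xs : List A) → length xs ≡ sumL xs (λ _ → 1)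
  length-sum [] = refl
  length-sum (x ∷ xs) = cong suc (length-sum xs)

  sumL-eq-pointwise : {A : Set} (xs : List A) {f g : A → ℕ} → (∀ x → f x ≤ g x) →
    sumL xs f ≡ sumL xs g → All (λ x → f x ≡ g x) xs
  sumL-eq-pointwise [] le eq = []
  sumL-eq-pointwise (x ∷ xs) {f} {g} le eq with m≤n⇒m<n∨m≡n (le x)
  ... | inj₂ e = e ∷ sumL-eq-pointwise xs le (+-cancelˡ-≡ (f x) _ _ (trans eq (cong (_+ sumL xs g) (sym e))))
  ... | inj₁ lt = ⊥-elim (<⇒≱ (+-mono-<-≤ lt (sumL-mono xs le)) (≤-reflexive (sym eq)))

  pairSum : {A : Set} → (A → A → ℕ) → List A → ℕ
  pairSum h [] = 0
  pairSum h (x ∷ xs) = sumL xs (h x) + pairSum h xs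

  pairSum-lemma : {A : Set} (h : A → A → ℕ) → (∀ x y → h x y ≡ h y x) → (∀ x → h x x ≡ 0) →
    (xs : List A) → sumL xs (λ x → sumL xs (h x)) ≡ 2 * pairSum h xs
  pairSum-lemma h hs h0 [] = refl
  pairSum-lemma h hs h0 (x ∷ xs) = begin
      (h x x + S) + sumL xs (λ y → h y x + sumL xs (h y))
        ≡⟨ cong₂ _+_ (cong (_+ S) (h0 x)) (sumL-+ xs (λ y → h y x) (λ y → sumL xs (h y))) ⟩
      S + (sumL xs (λ y → h y x) + sumL xs (λ y → sumL xs (h y)))
        ≡⟨ cong (λ z → S + (z + sumL xs (λ y → sumL xs (h y)))) (sumL-cong xs (λ y → hs y x)) ⟩
      S + (S + sumL xs (λ y → sumL xs (h y)))
        ≡⟨ cong (λ z → S + (S + z)) (pairSum-lemma h hs h0 xs) ⟩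
      S + (S + 2 * P)
        ≡⟨ arith S P ⟩
      2 * (S + P) ∎
    where
    open ≡-Reasoning
    S : ℕ
    S = sumL xs (h x)
    P : ℕ
    P = pairSum h xs
    arith : ∀ a b → a + (a + 2 * b) ≡ 2 * (a + b)
    arith = solve-∀

module Booleans where

  open import Data.Nat using (ℕ; _≤_; z≤n; s≤s)
  open import Data.Bool using (Bool; true; false; T?)
  import Data.Bool as B
  open import Relation.Nullary using (Dec; yes; no; ¬_; does)
  open import Relation.Binary.PropositionalEquality using (_≡_; refl; sym)
  open import Data.Empty using (⊥; ⊥-elim)
  open Sums using (χ)

  does-true : {P : Set} (d : Dec P) → does d ≡ true → P
  does-true (yes p) _ = p

  true-does : {P : Set} (d : Dec P) → P → does d ≡ true
  true-does (yes p) _ = refl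
  true-does (no ¬p) p = ⊥-elim (¬p p)

  bool-ext : (b c : Bool) → (b ≡ true → c ≡ true) → (c ≡ true → b ≡ true) → b ≡ c
  bool-ext true true f g = refl
  bool-ext true false f g = sym (f refl)
  bool-ext false true f g = g refl
  bool-ext false false f g = refl

  not-true : (b : Bool) → ¬ (b ≡ true) → b ≡ false
  not-true true n = ⊥-elim (n refl)
  not-true false n = refl

  not-false : (b : Bool) → ¬ (b ≡ false) → b ≡ true
  not-false true n = refl
  not-false false n = ⊥-elim (n refl)

  f≢t : false ≡ true → ⊥
  f≢t ()

  ind : Bool → ℕ
  ind true = 1
  ind false = 0

  ind≤1 : ∀ b → ind b ≤ 1
  ind≤1 true = s≤s z≤n
  ind≤1 false = z≤n

  χ-ind : (b : Bool) → χ (b B.≟ true) ≡ ind b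
  χ-ind true = refl
  χ-ind false = refl

  χT : (b : Bool) → χ (T? b) ≡ ind b
  χT true = refl
  χT false = refl

-- The enumeration
-- is complete and duplicate-free up to the ring equality ≈, so a sum over
-- it is a genuine sum over the ring as soon as the summand respects ≈.
module Enumeration where

  open import Defs
  open Sums
  open import Data.Nat using (ℕ; suc; _+_; _*_; _∸_; _≤_; _<_)
  open import Data.Nat.Properties
  open import Data.List using (List; []; _∷_)
  open import Data.List.Relation.Unary.Any using (Any; here; there; any?)
  import Data.List.Relation.Unary.All as All
  open import Data.List.Relation.Unary.AllPairs using (AllPairs; []; _∷_)
  open import Data.Product using (_,_; ∃)
  open import Relation.Nullary using (Dec; yes; no; ¬_)
  open import Relation.Binary.PropositionalEquality
  open import Data.Empty using (⊥-elim)
  open import Data.Bool using (Bool; true; false; if_then_else_)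

  module Over (F : FinCommRing) where
    open FinCommRing F using (Carrier; _≈_; _≈?_; elems; complete; unique) renaming (sym to ≈sym; trans to ≈trans)

    Σ' : (Carrier → ℕ) → ℕ
    Σ' f = sumL elems f

    Resp : (Carrier → ℕ) → Set
    Resp f = ∀ {x y} → x ≈ y → f x ≡ f y

    RespP : (Carrier → Set) → Set
    RespP P = ∀ {x y} → x ≈ y → P x → P y

    Resp-* : ∀ {f g} → Resp f → Resp g → Resp (λ x → f x * g x)
    Resp-* rf rg e = cong₂ _*_ (rf e) (rg e)

    Resp-∘ : ∀ {f} (h : Carrier → Carrier) → Resp f → (∀ {x y} → x ≈ y → h x ≈ h y) → Resp (λ x → f (h x))
    Resp-∘ h rf rh e = rf (rh e)

    Resp-χ : ∀ {P : Carrier → Set} (P? : ∀ x → Dec (P x)) → RespP P → Resp (λ x → χ (P? x))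
    Resp-χ P? rp e = χ-⇔ (rp e) (rp (≈sym e)) (P? _) (P? _)

    δ-absent : ∀ x (ys : List Carrier) → ¬ Any (x ≈_) ys → sumL ys (λ y → χ (x ≈? y)) ≡ 0
    δ-absent x [] _ = refl
    δ-absent x (y ∷ ys) na with x ≈? y
    ... | yes e = ⊥-elim (na (here e))
    ... | no _ = δ-absent x ys (λ a → na (there a))

    δ-present : ∀ x (ys : List Carrier) → AllPairs (λ a b → ¬ a ≈ b) ys →
      Any (x ≈_) ys → sumL ys (λ y → χ (x ≈? y)) ≡ 1
    δ-present x (y ∷ ys) (ay ∷ u) a with x ≈? y
    ... | yes e = cong suc (δ-absent x ys notin)
      where
      notin : ¬ Any (x ≈_) ys
      notin a' with All.lookupAny ay a'
      ... | (yz , xz) = yz (≈trans (≈sym e) xz)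
    δ-present x (y ∷ ys) (ay ∷ u) (here e) | no ne = ⊥-elim (ne e)
    δ-present x (y ∷ ys) (ay ∷ u) (there a) | no ne = δ-present x ys u a

    δ : ∀ x → Σ' (λ y → χ (x ≈? y)) ≡ 1
    δ x = δ-present x elems unique (complete x)

    δ' : ∀ x → Σ' (λ y → χ (y ≈? x)) ≡ 1
    δ' x = trans (sumL-cong elems (λ y → χ-⇔ ≈sym ≈sym (y ≈? x) (x ≈? y))) (δ x)

    pick : (f : Carrier → ℕ) → Resp f → ∀ x → Σ' (λ y → χ (x ≈? y) * f y) ≡ f x
    pick f rf x = begin
        Σ' (λ y → χ (x ≈? y) * f y) ≡⟨ sumL-cong elems (λ y → at y (x ≈? y)) ⟩
        Σ' (λ y → χ (x ≈? y) * f x) ≡⟨ sumL-*ʳ elems (f x) (λ y → χ (x ≈? y)) ⟩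
        Σ' (λ y → χ (x ≈? y)) * f x ≡⟨ cong (_* f x) (δ x) ⟩
        1 * f x ≡⟨ *-identityˡ (f x) ⟩
        f x ∎
      where
      open ≡-Reasoning
      at : ∀ y (d : Dec (x ≈ y)) → χ d * f y ≡ χ d * f x
      at y (yes e) = cong (_+ 0) (sym (rf e))
      at y (no _) = refl

    any⇒∃ : {P : Carrier → Set} {xs : List Carrier} → Any P xs → ∃ P
    any⇒∃ (here p) = _ , p
    any⇒∃ (there a) = any⇒∃ a

    ∃⇒any-list : {P : Carrier → Set} → RespP P → ∀ {x} (xs : List Carrier) → Any (x ≈_) xs → P x → Any P xs
    ∃⇒any-list rp (y ∷ ys) (here e) p = here (rp e p)
    ∃⇒any-list rp (y ∷ ys) (there a) p = there (∃⇒any-list rp ys a p)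

    ∃⇒any : {P : Carrier → Set} → RespP P → ∃ P → Any P elems
    ∃⇒any rp (x , p) = ∃⇒any-list rp elems (complete x) p

    ∃? : (P : Carrier → Set) → RespP P → (∀ x → Dec (P x)) → Dec (∃ P)
    ∃? P rp P? with any? P? elems
    ... | yes a = yes (any⇒∃ a)
    ... | no na = no (λ e → na (∃⇒any rp e))

    firstOr : (Carrier → Bool) → List Carrier → Carrier → Carrier
    firstOr p [] d = d
    firstOr p (z ∷ zs) d = if p z then z else firstOr p zs d

    fo-ext : ∀ (p p' : Carrier → Bool) (xs : List Carrier) (d d' : Carrier) → (∀ z → p z ≡ p' z) → Any (λ z → p z ≡ true) xs →
      firstOr p xs d ≡ firstOr p' xs d'
    fo-ext p p' (z ∷ zs) d d' e a with p z in eq | p' z in eq'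
    ... | true | true = refl
    ... | false | false = fo-ext p p' zs d d' e (tl a)
      where
      tl : Any (λ z → p z ≡ true) (z ∷ zs) → Any (λ z → p z ≡ true) zs
      tl (here q) with trans (sym q) eq
      ... | ()
      tl (there q) = q
    ... | true | false with trans (sym eq) (trans (e z) eq')
    ... | ()
    fo-ext p p' (z ∷ zs) d d' e a | false | true with trans (sym eq) (trans (e z) eq')
    ... | ()

    fo-sat : ∀ (p : Carrier → Bool) (xs : List Carrier) (d : Carrier) → Any (λ z → p z ≡ true) xs → p (firstOr p xs d) ≡ true
    fo-sat p (z ∷ zs) d a with p z in eq
    fo-sat p (z ∷ zs) d a | true = eq
    fo-sat p (z ∷ zs) d (here q) | false with trans (sym q) eq
    ... | ()
    fo-sat p (z ∷ zs) d (there q) | false = fo-sat p zs d q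

    fo-ext0 : ∀ (p p' : Carrier → Bool) (xs : List Carrier) (d : Carrier) → (∀ z → p z ≡ p' z) →
      firstOr p xs d ≡ firstOr p' xs d
    fo-ext0 p p' [] d e = refl
    fo-ext0 p p' (z ∷ zs) d e rewrite e z = cong (if_then_else_ (p' z) z) (fo-ext0 p p' zs d e)

    sum-eq-pw : (f g : Carrier → ℕ) → Resp f → Resp g → (∀ x → f x ≤ g x) →
      Σ' f ≡ Σ' g → ∀ x → f x ≡ g x
    sum-eq-pw f g rf rg le eq x with All.lookupAny (sumL-eq-pointwise elems le eq) (complete x)
    ... | (fz≡gz , xz) = trans (rf xz) (trans fz≡gz (rg (≈sym xz)))

    card≡ : card F ≡ Σ' (λ _ → 1)
    card≡ = length-sum elems

    le-sum : (h : Carrier → ℕ) → Resp h → ∀ x → h x ≤ Σ' h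
    le-sum h rh x = subst (_≤ Σ' h) (pick h rh x) (sumL-mono elems term≤)
      where
      term≤ : ∀ y → χ (x ≈? y) * h y ≤ h y
      term≤ y = subst (_≤ h y) (*-comm (h y) (χ (x ≈? y)))
        (subst (h y * χ (x ≈? y) ≤_) (*-identityʳ (h y)) (*-monoʳ-≤ (h y) (χ≤1 (x ≈? y))))

    sum-strict : (f g : Carrier → ℕ) → Resp f → Resp g → (∀ z → f z ≤ g z) → ∀ x → f x < g x → Σ' f < Σ' g
    sum-strict f g rf rg le x lt = begin-strict
        Σ' f <⟨ m<m+n (Σ' f) (≤-trans (m<n⇒0<n∸m lt) (le-sum (λ z → g z ∸ f z) (λ e → cong₂ _∸_ (rg e) (rf e)) x)) ⟩
        Σ' f + Σ' (λ z → g z ∸ f z) ≡⟨ sym (sumL-+ elems f (λ z → g z ∸ f z)) ⟩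
        Σ' (λ z → f z + (g z ∸ f z)) ≡⟨ sumL-cong elems (λ z → m+[n∸m]≡n (le z)) ⟩
        Σ' g ∎
      where
      open ≤-Reasoning

    sum-unique : (Q : Carrier → Set) (Q? : ∀ x → Dec (Q x)) (rq : RespP Q) →
      (∀ {u u'} → Q u → Q u' → u ≈ u') → Σ' (λ u → χ (Q? u)) ≡ χ (∃? Q rq Q?)
    sum-unique Q Q? rq uq with ∃? Q rq Q?
    ... | yes (u0 , q0) = trans (sumL-cong elems (λ u → χ-⇔ (λ qu → uq qu q0) (λ e → rq (≈sym e) q0) (Q? u) (u ≈? u0))) (δ' u0)
    ... | no nq = trans (sumL-cong elems (λ u → χ-no (Q? u) (λ qu → nq (u , qu)))) (sumL-0 elems)

  module Transfer (F G : FinCommRing) where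
    private
      module F = FinCommRing F
      module G = FinCommRing G
      module FF = Over F
      module GG = Over G

    transfer : (φ : F.Carrier → G.Carrier) (ψ : G.Carrier → F.Carrier) →
      (∀ x y → G._≈_ (φ x) y → F._≈_ x (ψ y)) → (∀ x y → F._≈_ x (ψ y) → G._≈_ (φ x) y) →
      (g : G.Carrier → ℕ) → GG.Resp g → FF.Σ' (λ x → g (φ x)) ≡ GG.Σ' g
    transfer φ ψ to fro g rg = begin
        FF.Σ' (λ x → g (φ x)) ≡⟨ sumL-cong F.elems (λ x → sym (GG.pick g rg (φ x))) ⟩
        FF.Σ' (λ x → GG.Σ' (λ y → χ (φ x G.≈? y) * g y)) ≡⟨ sumL-swap F.elems G.elems _ ⟩
        GG.Σ' (λ y → FF.Σ' (λ x → χ (φ x G.≈? y) * g y)) ≡⟨ sumL-cong G.elems (λ y → sumL-*ʳ F.elems (g y) _) ⟩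
        GG.Σ' (λ y → FF.Σ' (λ x → χ (φ x G.≈? y)) * g y) ≡⟨ sumL-cong G.elems (λ y → cong (_* g y) (one y)) ⟩
        GG.Σ' (λ y → 1 * g y) ≡⟨ sumL-cong G.elems (λ y → *-identityˡ (g y)) ⟩
        GG.Σ' g ∎
      where
      open ≡-Reasoning
      one : ∀ y → FF.Σ' (λ x → χ (φ x G.≈? y)) ≡ 1
      one y = trans (sumL-cong F.elems (λ x → χ-⇔ (to x y) (fro x y) (φ x G.≈? y) (x F.≈? ψ y))) (FF.δ' (ψ y))

module TriangleSums where

  open import Defs using (triples)
  open Sums
  open import Data.Nat using (ℕ; _+_; _*_)
  open import Data.Nat.Properties
  open import Data.List using (List; []; _∷_; _++_; map)
  open import Data.List.Properties using (++-cancelʳ)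
  open import Data.Product using (_×_; _,_)
  open import Relation.Binary.PropositionalEquality
  open import Data.Nat.Tactic.RingSolver using (solve-∀)

  module _ {A : Set} where
    rowTriples : A → List A → List (A × A × A)
    rowTriples x [] = []
    rowTriples x (y ∷ ys) = map (λ z → x , y , z) ys ++ rowTriples x ys

    -- the recursion equation of Defs.triples, with its local helper exposed
    triples-eq : ∀ x (xs : List A) → triples (x ∷ xs) ≡ rowTriples x xs ++ triples xs
    triples-eq x [] = refl
    triples-eq x (y ∷ ys) = cong (λ l → (map (λ z → x , y , z) ys ++ l) ++ triples (y ∷ ys))
      (++-cancelʳ (triples ys) _ _ (triples-eq x ys))

  -- For a symmetric weight a with zero diagonal, H x y z = a x y · a x z · a y z
  -- is invariant under permutations of (x, y, z) and vanishes when two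
  -- arguments coincide; hence its sum over all ordered triples of a list
  -- is 6 times its sum over the list's 'triples' (x before y before z).
  module TriCount {A : Set} (a : A → A → ℕ) (asym : ∀ x y → a x y ≡ a y x) (a0 : ∀ x → a x x ≡ 0) where
    H : A → A → A → ℕ
    H x y z = a x y * (a x z * a y z)

    h : A × A × A → ℕ
    h (x , y , z) = H x y z

    E : List A → ℕ
    E xs = sumL xs (λ x → sumL xs (λ y → sumL xs (λ z → H x y z)))

    Hsym1 : ∀ x y z → H y x z ≡ H x y z
    Hsym1 x y z rewrite asym y x = cong (a x y *_) (*-comm (a y z) (a x z))

    Hsym2 : ∀ x y z → H y z x ≡ H x y z
    Hsym2 x y z rewrite asym y x | asym z x = begin
        a y z * (a x y * a x z) ≡⟨ cong (a y z *_) (*-comm (a x y) (a x z)) ⟩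
        a y z * (a x z * a x y) ≡⟨ sym (*-assoc (a y z) _ _) ⟩
        a y z * a x z * a x y ≡⟨ *-comm (a y z * a x z) (a x y) ⟩
        a x y * (a y z * a x z) ≡⟨ cong (a x y *_) (*-comm (a y z) (a x z)) ⟩
        a x y * (a x z * a y z) ∎
      where open ≡-Reasoning

    Hsym3 : ∀ x y z → H x z y ≡ H x y z
    Hsym3 x y z rewrite asym z y = begin
        a x z * (a x y * a y z) ≡⟨ sym (*-assoc (a x z) _ _) ⟩
        a x z * a x y * a y z ≡⟨ cong (_* a y z) (*-comm (a x z) (a x y)) ⟩
        a x y * a x z * a y z ≡⟨ *-assoc (a x y) _ _ ⟩
        a x y * (a x z * a y z) ∎
      where open ≡-Reasoning

    Hxx : ∀ x z → H x x z ≡ 0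
    Hxx x z rewrite a0 x = refl

    Hxzx : ∀ x y → H x y x ≡ 0
    Hxzx x y rewrite a0 x = *-zeroʳ (a x y)

    Hyxx : ∀ x y → H y x x ≡ 0
    Hyxx x y rewrite a0 x = trans (cong (a y x *_) (*-zeroʳ (a y x))) (*-zeroʳ (a y x))

    Hxyy : ∀ {x} y → H x y y ≡ 0
    Hxyy {x} y rewrite a0 y = trans (cong (a x y *_) (*-zeroʳ (a x y))) (*-zeroʳ (a x y))

    rowTriples-sum : ∀ x (t : List A) → sumL (rowTriples x t) h ≡ pairSum (H x) t
    rowTriples-sum x [] = refl
    rowTriples-sum x (y ∷ ys) = trans (sumL-++ (map (λ z → x , y , z) ys) (rowTriples x ys) h)
      (cong₂ _+_ (sumL-map ys (λ z → x , y , z) h) (rowTriples-sum x ys))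

    S : A → List A → ℕ
    S x t = sumL t (λ y → sumL t (λ z → H x y z))

    S≡ : ∀ x t → S x t ≡ 2 * pairSum (H x) t
    S≡ x t = pairSum-lemma (H x) (λ y z → sym (Hsym3 x y z)) Hxyy t

    -- peeling off the head x: each of the three positions of x contributes S x t
    E-step : ∀ x t → E (x ∷ t) ≡ 3 * S x t + E t
    E-step x t = begin
        (H x x x + sumL t (λ z → H x x z)) + sumL t (λ y → H x y x + sumL t (λ z → H x y z))
          + sumL t (λ x' → (H x' x x + sumL t (λ z → H x' x z)) + sumL t (λ y → H x' y x + sumL t (λ z → H x' y z)))
        ≡⟨ cong₂ (λ u v → u + v + sumL t (λ x' → (H x' x x + sumL t (λ z → H x' x z)) + sumL t (λ y → H x' y x + sumL t (λ z → H x' y z))))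
             (trans (cong (_+ sumL t (λ z → H x x z)) (Hxx x x)) (trans (sumL-cong t (Hxx x)) (sumL-0 t)))
             (sumL-cong t (λ y → cong (_+ sumL t (λ z → H x y z)) (Hxzx x y))) ⟩
        S x t + sumL t (λ x' → (H x' x x + sumL t (λ z → H x' x z)) + sumL t (λ y → H x' y x + sumL t (λ z → H x' y z)))
        ≡⟨ cong (S x t +_) (sumL-cong t (λ x' → cong₂ _+_ (cong (_+ sumL t (λ z → H x' x z)) (Hyxx x x'))
              (sumL-+ t (λ y → H x' y x) (λ y → sumL t (λ z → H x' y z))))) ⟩
        S x t + sumL t (λ x' → sumL t (λ z → H x' x z) + (sumL t (λ y → H x' y x) + sumL t (λ y → sumL t (λ z → H x' y z))))
        ≡⟨ cong (S x t +_) (trans (sumL-+ t _ _) (cong (sumL t (λ x' → sumL t (λ z → H x' x z)) +_) (sumL-+ t _ _))) ⟩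
        S x t + (sumL t (λ x' → sumL t (λ z → H x' x z)) + (sumL t (λ x' → sumL t (λ y → H x' y x)) + E t))
        ≡⟨ cong (λ u → S x t + (u + (sumL t (λ x' → sumL t (λ y → H x' y x)) + E t)))
             (sumL-cong t (λ x' → sumL-cong t (λ z → Hsym1 x x' z))) ⟩
        S x t + (S x t + (sumL t (λ x' → sumL t (λ y → H x' y x)) + E t))
        ≡⟨ cong (λ u → S x t + (S x t + (u + E t)))
             (sumL-cong t (λ x' → sumL-cong t (λ y → Hsym2 x x' y))) ⟩
        S x t + (S x t + (S x t + E t))
        ≡⟨ ar (S x t) (E t) ⟩
        3 * S x t + E t ∎
      where
      open ≡-Reasoning
      ar : ∀ s e → s + (s + (s + e)) ≡ 3 * s + e
      ar = solve-∀

    main : ∀ (xs : List A) → 6 * sumL (triples xs) h ≡ E xs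
    main [] = refl
    main (x ∷ t) = begin
        6 * sumL (triples (x ∷ t)) h ≡⟨ cong (λ l → 6 * sumL l h) (triples-eq x t) ⟩
        6 * sumL (rowTriples x t ++ triples t) h ≡⟨ cong (6 *_) (sumL-++ (rowTriples x t) (triples t) h) ⟩
        6 * (sumL (rowTriples x t) h + sumL (triples t) h) ≡⟨ cong (λ u → 6 * (u + sumL (triples t) h)) (rowTriples-sum x t) ⟩
        6 * (pairSum (H x) t + sumL (triples t) h) ≡⟨ ar (pairSum (H x) t) (sumL (triples t) h) ⟩
        3 * (2 * pairSum (H x) t) + 6 * sumL (triples t) h ≡⟨ cong₂ (λ u v → 3 * u + v) (sym (S≡ x t)) (main t) ⟩
        3 * S x t + E t ≡⟨ sym (E-step x t) ⟩
        E (x ∷ t) ∎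
      where
      open ≡-Reasoning
      ar : ∀ p s → 6 * (p + s) ≡ 3 * (2 * p) + 6 * s
      ar = solve-∀

module RingFacts where

  open import Level using (0ℓ)
  open import Algebra.Bundles using (CommutativeRing)
  open import Data.Product using (_,_; ∃)
  open import Relation.Nullary using (¬_)
  import Algebra.Properties.Ring as RingProperties
  import Algebra.Properties.CommutativeSemigroup as CSProps
  import Algebra.Solver.CommutativeMonoid as CMSolver

  module RL (CR : CommutativeRing 0ℓ 0ℓ) where
    open CommutativeRing CR
    open RingProperties ring public
    open CMSolver +-commutativeMonoid using (solve; _⊕_; _⊜_)
    open import Relation.Binary.Reasoning.Setoid setoid

    +-interchange : ∀ a b c d → (a + b) + (c + d) ≈ (a + c) + (b + d)
    +-interchange = CSProps.interchange +-commutativeSemigroup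

    *-interchange : ∀ a b c d → (a * b) * (c * d) ≈ (a * c) * (b * d)
    *-interchange = CSProps.interchange *-commutativeSemigroup

    ideal-+ : ∀ a r b s x → (a + r * x) + (b + s * x) ≈ (a + b) + (r + s) * x
    ideal-+ a r b s x = begin
      (a + r * x) + (b + s * x) ≈⟨ +-interchange a (r * x) b (s * x) ⟩
      (a + b) + (r * x + s * x) ≈⟨ +-congˡ (sym (distribʳ x r s)) ⟩
      (a + b) + (r + s) * x ∎

    ideal-* : ∀ t a r x → t * (a + r * x) ≈ t * a + (t * r) * x
    ideal-* t a r x = begin
      t * (a + r * x) ≈⟨ distribˡ t a (r * x) ⟩
      t * a + t * (r * x) ≈⟨ +-congˡ (sym (*-assoc t r x)) ⟩
      t * a + (t * r) * x ∎

    0+0*x : ∀ x → 0# ≈ 0# + 0# * x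
    0+0*x x = sym (trans (+-identityˡ _) (zeroˡ x))

    a≈a+0x : ∀ a x → a ≈ a + 0# * x
    a≈a+0x a x = sym (trans (+-congˡ (zeroˡ x)) (+-identityʳ a))

    x≈0+1x : ∀ x → x ≈ 0# + 1# * x
    x≈0+1x x = sym (trans (+-identityˡ _) (*-identityˡ x))

    neg-sq : ∀ u → (- u) * (- u) ≈ u * u
    neg-sq u = begin
      (- u) * (- u) ≈⟨ sym (-‿distribˡ-* u (- u)) ⟩
      - (u * - u) ≈⟨ -‿cong (sym (-‿distribʳ-* u u)) ⟩
      - - (u * u) ≈⟨ -‿involutive (u * u) ⟩
      u * u ∎

    diff-sq : ∀ u v → (u + - v) * (u + v) ≈ u * u + - (v * v)
    diff-sq u v = begin
      (u + - v) * (u + v) ≈⟨ distribʳ (u + v) u (- v) ⟩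
      u * (u + v) + - v * (u + v) ≈⟨ +-cong (distribˡ u u v) (distribˡ (- v) u v) ⟩
      (u * u + u * v) + (- v * u + - v * v) ≈⟨ +-interchange _ _ _ _ ⟩
      (u * u + - v * u) + (u * v + - v * v) ≈⟨ +-cong (+-congˡ (sym (-‿distribˡ-* v u))) (+-cong (*-comm u v) (sym (-‿distribˡ-* v v))) ⟩
      (u * u + - (v * u)) + (v * u + - (v * v)) ≈⟨ +-assoc _ _ _ ⟩
      u * u + (- (v * u) + (v * u + - (v * v))) ≈⟨ +-congˡ (sym (+-assoc _ _ _)) ⟩
      u * u + ((- (v * u) + v * u) + - (v * v)) ≈⟨ +-congˡ (+-congʳ (-‿inverseˡ _)) ⟩
      u * u + (0# + - (v * v)) ≈⟨ +-congˡ (+-identityˡ _) ⟩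
      u * u + - (v * v) ∎

    telescope : ∀ x y z → (x + - y) + (y + - z) ≈ x + - z
    telescope x y z = begin
      (x + - y) + (y + - z) ≈⟨ solve 4 (λ x y' y z' → (x ⊕ y') ⊕ (y ⊕ z') ⊜ (x ⊕ (y' ⊕ y)) ⊕ z') refl x (- y) y (- z) ⟩
      (x + (- y + y)) + - z ≈⟨ +-congʳ (+-congˡ (-‿inverseˡ y)) ⟩
      (x + 0#) + - z ≈⟨ +-congʳ (+-identityʳ x) ⟩
      x + - z ∎

    shift-lemma : ∀ a y → (a + 1#) + - y ≈ (a + - (y + 1#)) + (1# + 1#)
    shift-lemma a y = begin
      (a + 1#) + - y ≈⟨ solve 3 (λ a i y' → (a ⊕ i) ⊕ y' ⊜ ((a ⊕ y') ⊕ i)) refl a 1# (- y) ⟩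
      (a + - y) + 1# ≈⟨ sym (+-identityʳ _) ⟩
      ((a + - y) + 1#) + 0# ≈⟨ +-congˡ (sym (-‿inverseˡ 1#)) ⟩
      ((a + - y) + 1#) + (- 1# + 1#) ≈⟨ solve 4 (λ a y' i j → ((a ⊕ y') ⊕ i) ⊕ (j ⊕ i) ⊜ (a ⊕ (j ⊕ y')) ⊕ (i ⊕ i)) refl a (- y) 1# (- 1#) ⟩
      (a + (- 1# + - y)) + (1# + 1#) ≈⟨ +-congʳ (+-congˡ (sym (-‿anti-homo-+ y 1#))) ⟩
      (a + - (y + 1#)) + (1# + 1#) ∎

    cancel-pair : ∀ u v → (u + - v) + (u + v) ≈ u + u
    cancel-pair u v = begin
      (u + - v) + (u + v) ≈⟨ solve 3 (λ u v' v → (u ⊕ v') ⊕ (u ⊕ v) ⊜ (u ⊕ u) ⊕ (v' ⊕ v)) refl u (- v) v ⟩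
      (u + u) + (- v + v) ≈⟨ +-congˡ (-‿inverseˡ v) ⟩
      (u + u) + 0# ≈⟨ +-identityʳ _ ⟩
      u + u ∎

    Unit : Carrier → Set
    Unit x = ∃ λ y → x * y ≈ 1#

    Unit-resp : ∀ {x x'} → x ≈ x' → Unit x → Unit x'
    Unit-resp e (y , p) = y , trans (*-congʳ (sym e)) p

    Unit-* : ∀ {x y} → Unit x → Unit y → Unit (x * y)
    Unit-* (a , p) (b , q) = a * b , trans (*-interchange _ _ _ _) (trans (*-cong p q) (*-identityˡ 1#))

    Unit-1 : Unit 1#
    Unit-1 = 1# , *-identityˡ 1#

    Unit-neg : ∀ {x} → Unit x → Unit (- x)
    Unit-neg {x} (a , p) = - a , trans (sym (-‿distribˡ-* x (- a))) (trans (-‿cong (sym (-‿distribʳ-* x a))) (trans (-‿involutive _) p))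

    Unit-factorʳ : ∀ {x y} → Unit (x * y) → Unit y
    Unit-factorʳ {x} {y} (a , p) = x * a , trans (sym (*-assoc y x a)) (trans (*-congʳ (*-comm y x)) p)

    unit-cancel : ∀ {u b} → Unit u → u * b ≈ 0# → b ≈ 0#
    unit-cancel {u} {b} (a , p) e = begin
      b ≈⟨ sym (*-identityˡ b) ⟩
      1# * b ≈⟨ *-congʳ (sym p) ⟩
      (u * a) * b ≈⟨ *-congʳ (*-comm u a) ⟩
      (a * u) * b ≈⟨ *-assoc a u b ⟩
      a * (u * b) ≈⟨ *-congˡ e ⟩
      a * 0# ≈⟨ zeroʳ a ⟩
      0# ∎

    inv-unique : ∀ {x a b} → x * a ≈ 1# → x * b ≈ 1# → a ≈ b
    inv-unique {x} {a} {b} p q = begin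
      a ≈⟨ sym (*-identityˡ a) ⟩
      1# * a ≈⟨ *-congʳ (sym q) ⟩
      (x * b) * a ≈⟨ *-congʳ (*-comm x b) ⟩
      (b * x) * a ≈⟨ *-assoc b x a ⟩
      b * (x * a) ≈⟨ *-congˡ p ⟩
      b * 1# ≈⟨ *-identityʳ b ⟩
      b ∎

    1≉0⇒unit≉0 : ¬ (1# ≈ 0#) → ∀ {u} → Unit u → ¬ (u ≈ 0#)
    1≉0⇒unit≉0 n {u} (a , p) e = n (trans (sym p) (trans (*-congʳ e) (zeroˡ a)))

module CayleyGraph where

  open import Defs
  open Sums
  open Enumeration
  open RingFacts
  open TriangleSums
  open Booleans using (does-true; true-does; bool-ext)
  open import Data.Nat using (ℕ) renaming (_*_ to _*ℕ_)
  import Data.Nat.Properties as N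
  open import Data.List.Relation.Unary.Any using (Any)
  import Data.List.Relation.Unary.Any as Any
  open import Data.Product using (_×_; _,_; ∃)
  open import Relation.Nullary using (Dec; ¬_; does)
  open import Relation.Nullary.Decidable using (_×-dec_; _⊎-dec_)
  open import Relation.Binary.PropositionalEquality using (_≡_; cong; cong₂) renaming (sym to ≡sym; trans to ≡trans)
  open import Data.Sum using (_⊎_; inj₁; inj₂)
  import Data.Sum as Sum

  module Cayley (F : FinCommRing) where
    open FinCommRing F using (Carrier; _≈_; _≈?_; elems; complete; 1#; 0#; setoid; +-cong; +-congˡ; +-congʳ; *-cong; *-congˡ; *-congʳ;
      +-comm; +-assoc; *-comm; *-assoc; +-identityˡ; +-identityʳ; *-identityˡ; -‿cong; -‿inverseʳ; -‿inverseˡ; distribʳ)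
      renaming (_+_ to _+r_; _*_ to _*r_; -_ to -r_; sym to ≈sym; trans to ≈trans)
    open RL (FinCommRing.cring F) public
    open Over F public

    Δ : (Carrier → ℕ) → ℕ
    Δ s = Σ' (λ x → Σ' (λ y → Σ' (λ z → s (x +r -r y) *ℕ (s (x +r -r z) *ℕ s (y +r -r z)))))

    Δ-cong : ∀ {s s'} → (∀ x → s x ≡ s' x) → Δ s ≡ Δ s'
    Δ-cong e = sumL-cong elems (λ x → sumL-cong elems (λ y → sumL-cong elems (λ z → cong₂ _*ℕ_ (e _) (cong₂ _*ℕ_ (e _) (e _)))))

    Unit? : ∀ x → Dec (Unit x)
    Unit? x = ∃? (λ y → x *r y ≈ 1#) (λ e p → ≈trans (*-congˡ (≈sym e)) p) (λ y → (x *r y) ≈? 1#)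

    Sq : Carrier → Set
    Sq x = ∃ λ u → Unit u × x ≈ u *r u

    Sq? : ∀ x → Dec (Sq x)
    Sq? x = ∃? (λ u → Unit u × x ≈ u *r u) root-resp (λ u → Unit? u ×-dec (x ≈? (u *r u)))
      where
      root-resp : RespP (λ u → Unit u × x ≈ u *r u)
      root-resp e (uu , p) = Unit-resp e uu , ≈trans p (*-cong e e)

    Sq-resp : RespP Sq
    Sq-resp e (u , uu , p) = u , uu , ≈trans (≈sym e) p

    Sq⇒Unit : ∀ {x} → Sq x → Unit x
    Sq⇒Unit (u , uu , p) = Unit-resp (≈sym p) (Unit-* uu uu)

    Sq-mul : ∀ {a b} → Sq a → Sq b → Sq (a *r b)
    Sq-mul (u , uu , e) (v , uv , f) = u *r v , Unit-* uu uv , ≈trans (*-cong e f) (*-interchange u u v v)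

    χSq-resp : Resp (λ x → χ (Sq? x))
    χSq-resp = Resp-χ Sq? Sq-resp

    Sq-neg : Sq (-r 1#) → ∀ {x} → Sq x → Sq (-r x)
    Sq-neg s1 {x} s = Sq-resp (-1*x≈-x x) (Sq-mul s1 s)

    Sq-unneg : Sq (-r 1#) → ∀ {x} → Sq (-r x) → Sq x
    Sq-unneg s1 {x} s = Sq-resp (-‿involutive x) (Sq-neg s1 s)

    Nn : ℕ
    Nn = Σ' (λ _ → 1)

    card≡N : card F ≡ Nn
    card≡N = card≡

    U : Carrier → ℕ
    U x = χ (Unit? x)

    Uresp : Resp U
    Uresp e = χ-⇔ (Unit-resp e) (Unit-resp (≈sym e)) (Unit? _) (Unit? _)

    units : ℕ
    units = Σ' U

    unitCard≡ : unitCard F ≡ units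
    unitCard≡ = ≡trans (length-filter (isUnit? F) elems)
      (sumL-cong elems (λ x → χ-⇔ any⇒∃ (∃⇒any (λ e p → ≈trans (*-congˡ (≈sym e)) p)) (isUnit? F x) (Unit? x)))

    sub-sub : ∀ c x → c +r -r (c +r -r x) ≈ x
    sub-sub c x = begin
        c +r -r (c +r -r x) ≈⟨ +-congˡ (⁻¹-anti-homo‿- c x) ⟩
        c +r (x +r -r c) ≈⟨ +-congˡ (+-comm x (-r c)) ⟩
        c +r (-r c +r x) ≈⟨ ≈sym (+-assoc c (-r c) x) ⟩
        (c +r -r c) +r x ≈⟨ +-congʳ (-‿inverseʳ c) ⟩
        0# +r x ≈⟨ +-identityˡ x ⟩
        x ∎
      where open import Relation.Binary.Reasoning.Setoid setoid

    add-sub : ∀ x c → (x +r c) +r -r c ≈ x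
    add-sub x c = ≈trans (+-assoc x c (-r c)) (≈trans (+-congˡ (-‿inverseʳ c)) (+-identityʳ x))

    sub-add : ∀ x c → (x +r -r c) +r c ≈ x
    sub-add x c = ≈trans (+-assoc x (-r c) c) (≈trans (+-congˡ (-‿inverseˡ c)) (+-identityʳ x))

    inv-mul : ∀ {c a} → c *r a ≈ 1# → ∀ x → a *r (c *r x) ≈ x
    inv-mul {c} {a} p x = ≈trans (≈sym (*-assoc a c x)) (≈trans (*-congʳ (≈trans (*-comm a c) p)) (*-identityˡ x))

    tr-neg : (f : Carrier → ℕ) → Resp f → Σ' (λ x → f (-r x)) ≡ Σ' f
    tr-neg f rf = Transfer.transfer F F -r_ -r_ (λ x y e → ≈trans (≈sym (-‿involutive x)) (-‿cong e))
      (λ x y e → ≈trans (-‿cong e) (-‿involutive y)) f rf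

    tr-sub : ∀ c (f : Carrier → ℕ) → Resp f → Σ' (λ x → f (c +r -r x)) ≡ Σ' f
    tr-sub c f rf = Transfer.transfer F F (λ x → c +r -r x) (λ y → c +r -r y)
      (λ x y e → ≈trans (≈sym (sub-sub c x)) (+-congˡ (-‿cong e)))
      (λ x y e → ≈trans (+-congˡ (-‿cong e)) (sub-sub c y)) f rf

    tr-add : ∀ c (f : Carrier → ℕ) → Resp f → Σ' (λ x → f (x +r c)) ≡ Σ' f
    tr-add c f rf = Transfer.transfer F F (λ x → x +r c) (λ y → y +r -r c)
      (λ x y e → ≈trans (≈sym (add-sub x c)) (+-congʳ e))
      (λ x y e → ≈trans (+-congʳ e) (sub-add y c)) f rf

    tr-mul : ∀ {c} → Unit c → (f : Carrier → ℕ) → Resp f → Σ' (λ x → f (c *r x)) ≡ Σ' f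
    tr-mul {c} (a , p) f rf = Transfer.transfer F F (λ x → c *r x) (λ y → a *r y)
      (λ x y e → ≈trans (≈sym (inv-mul p x)) (*-congˡ e))
      (λ x y e → ≈trans (*-congˡ e) (inv-mul (≈trans (*-comm a c) p) y)) f rf

    -- A s c = Σ_t s(t) s(t - c): for the adjacency weight s, the number of
    -- common neighbours of two vertices at difference c
    A : (Carrier → ℕ) → Carrier → ℕ
    A s c = Σ' (λ t → s t *ℕ s (t +r -r c))

    common-neighbours : ∀ s → Resp s → ∀ x y → Σ' (λ z → s (x +r -r z) *ℕ s (y +r -r z)) ≡ A s (x +r -r y)
    common-neighbours s rs x y = ≡trans (sumL-cong elems (λ z → cong (s (x +r -r z) *ℕ_) (rs (≈sym (shift z)))))
      (tr-sub x (λ t → s t *ℕ s (t +r -r (x +r -r y))) (Resp-* rs (Resp-∘ (λ t → t +r -r (x +r -r y)) rs (λ e → +-congʳ e))))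
      where
      shift : ∀ z → (x +r -r z) +r -r (x +r -r y) ≈ y +r -r z
      shift z = ≈trans (+-congˡ (⁻¹-anti-homo‿- x y)) (≈trans (+-comm _ _) (telescope y x z))

    const-sum : ∀ c → Σ' (λ _ → c) ≡ Nn *ℕ c
    const-sum c = ≡trans (sumL-cong elems (λ _ → ≡sym (N.*-identityˡ c))) (sumL-*ʳ elems c (λ _ → 1))

    Δ-regular : ∀ s → Resp s → (K : ℕ) → (∀ c → s c *ℕ A s c ≡ s c *ℕ K) → Δ s ≡ Nn *ℕ (Σ' s *ℕ K)
    Δ-regular s rs K hK = begin
        Δ s ≡⟨ sumL-cong elems (λ x → sumL-cong elems (λ y → sumL-*ˡ elems (s (x +r -r y)) _)) ⟩
        Σ' (λ x → Σ' (λ y → s (x +r -r y) *ℕ Σ' (λ z → s (x +r -r z) *ℕ s (y +r -r z))))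
          ≡⟨ sumL-cong elems (λ x → sumL-cong elems (λ y → cong (s (x +r -r y) *ℕ_) (common-neighbours s rs x y))) ⟩
        Σ' (λ x → Σ' (λ y → s (x +r -r y) *ℕ A s (x +r -r y)))
          ≡⟨ sumL-cong elems (λ x → sumL-cong elems (λ y → hK (x +r -r y))) ⟩
        Σ' (λ x → Σ' (λ y → s (x +r -r y) *ℕ K))
          ≡⟨ sumL-cong elems (λ x → ≡trans (sumL-*ʳ elems K (λ y → s (x +r -r y))) (cong (_*ℕ K) (tr-sub x s rs))) ⟩
        Σ' (λ x → Σ' s *ℕ K) ≡⟨ const-sum _ ⟩
        Nn *ℕ (Σ' s *ℕ K) ∎
      where open Relation.Binary.PropositionalEquality.≡-Reasoning

    two : Carrier
    two = 1# +r 1#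

    two*x : ∀ x → two *r x ≈ x +r x
    two*x x = ≈trans (distribʳ x 1# 1#) (+-cong (*-identityˡ x) (*-identityˡ x))

    inv : Carrier → Carrier
    inv x = firstOr (λ y → does ((x *r y) ≈? 1#)) elems 0#

    inv-spec : ∀ {x} → Unit x → x *r inv x ≈ 1#
    inv-spec {x} (a , p) = does-true ((x *r inv x) ≈? 1#)
      (fo-sat (λ y → does ((x *r y) ≈? 1#)) elems 0#
        (Any.map (λ {z} e → true-does ((x *r z) ≈? 1#) (≈trans (*-congˡ (≈sym e)) p)) (complete a)))

    inv-resp : ∀ {x x'} → x ≈ x' → inv x ≡ inv x'
    inv-resp {x} {x'} e = fo-ext0 _ _ elems 0# (λ z → bool-ext _ _
      (λ p → true-does ((x' *r z) ≈? 1#) (≈trans (*-congʳ (≈sym e)) (does-true ((x *r z) ≈? 1#) p)))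
      (λ p → true-does ((x *r z) ≈? 1#) (≈trans (*-congʳ e) (does-true ((x' *r z) ≈? 1#) p))))

    inv-unit : ∀ {x} → Unit x → Unit (inv x)
    inv-unit {x} u = x , ≈trans (*-comm (inv x) x) (inv-spec u)

    inv-inv : ∀ {x} → Unit x → inv (inv x) ≈ x
    inv-inv {x} u = inv-unique (inv-spec (inv-unit u)) (≈trans (*-comm (inv x) x) (inv-spec u))

    inv1 : inv 1# ≈ 1#
    inv1 = inv-unique (inv-spec Unit-1) (*-identityˡ 1#)

    inv-self : ∀ {x} → Unit x → x *r x ≈ 1# → inv x ≈ x
    inv-self u e = inv-unique (inv-spec u) e

    Sq-inv : ∀ x → Sq x → Sq (inv x)
    Sq-inv x (u , uu , e) = inv u , inv-unit uu ,
      inv-unique (inv-spec (Sq⇒Unit (u , uu , e)))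
        (≈trans (*-congʳ e) (≈trans (*-interchange u u (inv u) (inv u)) (≈trans (*-cong (inv-spec uu) (inv-spec uu)) (*-identityˡ 1#))))

    Sq-div : ∀ {c x} → Sq c → Sq (c *r x) → Sq x
    Sq-div {c} {x} sc scx = Sq-resp (inv-mul (inv-spec (Sq⇒Unit sc)) x) (Sq-mul (Sq-inv c sc) scx)

    InT : Carrier → Set
    InT x = Sq x ⊎ Sq (-r x)

    InT? : ∀ x → Dec (InT x)
    InT? x = Sq? x ⊎-dec Sq? (-r x)

    InT-resp : RespP InT
    InT-resp e (inj₁ s) = inj₁ (Sq-resp e s)
    InT-resp e (inj₂ s) = inj₂ (Sq-resp (-‿cong e) s)

    InT-neg : ∀ {x} → InT x → InT (-r x)
    InT-neg {x} (inj₁ s) = inj₂ (Sq-resp (≈sym (-‿involutive x)) s)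
    InT-neg (inj₂ s) = inj₁ s

    InT-Sq : Sq (-r 1#) → ∀ x → χ (InT? x) ≡ χ (Sq? x)
    InT-Sq s1 x = χ-⇔ (λ { (inj₁ s) → s ; (inj₂ s) → Sq-unneg s1 s }) inj₁ (InT? x) (Sq? x)

    InTDefs : Carrier → Set
    InTDefs x = Any (λ u → Any (λ y → u *r y ≈ 1#) elems × ((x ≈ u *r u) ⊎ (x ≈ -r (u *r u)))) elems

    InTDefs⇒InT : ∀ {x} → InTDefs x → InT x
    InTDefs⇒InT {x} a with any⇒∃ a
    ... | u , au , inj₁ e = inj₁ (u , any⇒∃ au , e)
    ... | u , au , inj₂ e = inj₂ (u , any⇒∃ au , ≈trans (-‿cong e) (-‿involutive _))

    InTDefs-intro : ∀ {x} u → Unit u → (x ≈ u *r u) ⊎ (x ≈ -r (u *r u)) → InTDefs x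
    InTDefs-intro {x} u uu s = ∃⇒any witness-resp (u , ∃⇒any inverse-resp uu , s)
      where
      inverse-resp : RespP (λ y → u *r y ≈ 1#)
      inverse-resp e p = ≈trans (*-congˡ (≈sym e)) p
      witness-resp : RespP (λ u → Any (λ y → u *r y ≈ 1#) elems × ((x ≈ u *r u) ⊎ (x ≈ -r (u *r u))))
      witness-resp e (au , s) = Any.map (λ p → ≈trans (*-congʳ (≈sym e)) p) au ,
        Sum.map (λ f → ≈trans f (*-cong e e)) (λ f → ≈trans f (-‿cong (*-cong e e))) s

    InT⇒InTDefs : ∀ {x} → InT x → InTDefs x
    InT⇒InTDefs (inj₁ (u , uu , e)) = InTDefs-intro u uu (inj₁ e)
    InT⇒InTDefs {x} (inj₂ (u , uu , e)) = InTDefs-intro u uu (inj₂ (≈trans (≈sym (-‿involutive x)) (-‿cong e)))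

    τ : Carrier → ℕ
    τ x = χ (inT? F x)

    τ≡ : ∀ x → τ x ≡ χ (InT? x)
    τ≡ x = χ-⇔ InTDefs⇒InT InT⇒InTDefs (inT? F x) (InT? x)

    τ-resp : Resp τ
    τ-resp e = ≡trans (τ≡ _) (≡trans (Resp-χ InT? InT-resp e) (≡sym (τ≡ _)))

    Δτ≡ΔQ : Sq (-r 1#) → Δ τ ≡ Δ (λ x → χ (Sq? x))
    Δτ≡ΔQ s1 = Δ-cong (λ x → ≡trans (τ≡ x) (InT-Sq s1 x))

    0∉T : ¬ (1# ≈ 0#) → ∀ x → ¬ InT (x +r -r x)
    0∉T n x (inj₁ (u , uu , e)) = 1≉0⇒unit≉0 n (Unit-* uu uu) (≈trans (≈sym e) (-‿inverseʳ x))
    0∉T n x (inj₂ (u , uu , e)) = 1≉0⇒unit≉0 n (Unit-* uu uu) (≈trans (≈sym e) (≈trans (-‿cong (-‿inverseʳ x)) -0#≈0#))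

    -- 6 n3(𝒢_F) = Δ τ: the adjacency weight is symmetric (T_F = -T_F) with
    -- zero diagonal, so the six-fold symmetry of triangle sums applies
    n3≡Δ : ¬ (1# ≈ 0#) → 6 *ℕ n3 F ≡ Δ τ
    n3≡Δ n = ≡trans (cong (6 *ℕ_) (≡trans (length-filter _ (triples elems))
                                            (sumL-cong (triples elems) λ { (x , y , z) → weight x y z })))
                    (TC.main elems)
      where
      a : Carrier → Carrier → ℕ
      a x y = τ (x +r -r y)
      a-sym : ∀ x y → a x y ≡ a y x
      a-sym x y = ≡trans (τ≡ _) (≡trans (χ-⇔ (flip x y) (flip y x) (InT? _) (InT? _)) (≡sym (τ≡ _)))
        where
        flip : ∀ x y → InT (x +r -r y) → InT (y +r -r x)
        flip x y t = InT-resp (⁻¹-anti-homo‿- x y) (InT-neg t)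
      a-diag : ∀ x → a x x ≡ 0
      a-diag x = ≡trans (τ≡ _) (χ-no (InT? _) (0∉T n x))
      module TC = TriCount a a-sym a-diag
      weight : ∀ x y z → χ (adj? F x y ×-dec (adj? F x z ×-dec adj? F y z)) ≡ TC.H x y z
      weight x y z = ≡trans (χ-× (adj? F x y) (adj? F x z ×-dec adj? F y z)) (cong (a x y *ℕ_) (χ-× (adj? F x z) (adj? F y z)))

-- The triangle count is an isomorphism invariant: a ring isomorphism
-- φ : R ≅ G maps units, squares and T_R onto their counterparts in G, and
-- reindexing along φ identifies the two triangle sums.
module Isomorphism where

  open import Defs
  open Sums
  open Enumeration
  open CayleyGraph
  open import Data.Nat using (ℕ) renaming (_*_ to _*ℕ_)
  open import Data.Product using (_,_; proj₁; proj₂)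
  open import Relation.Nullary using (¬_)
  open import Relation.Binary.PropositionalEquality using (_≡_; cong; cong₂) renaming (sym to ≡sym; trans to ≡trans)
  open import Data.Sum using (inj₁; inj₂)
  open import Algebra.Morphism.Structures using (module RingMorphisms)

  module Iso (R G : FinCommRing) (iso : FinCommRing.cring R ≅ FinCommRing.cring G) where
    private
      module R = FinCommRing R
      module G = FinCommRing G
      module CR = Cayley R
      module CG = Cayley G

    φ : R.Carrier → G.Carrier
    φ = proj₁ iso

    open RingMorphisms.IsRingIsomorphism (proj₂ iso)

    ψ : G.Carrier → R.Carrier
    ψ y = proj₁ (surjective y)

    φψ : ∀ y → φ (ψ y) G.≈ y
    φψ y = proj₂ (surjective y) R.refl

    reindex : (g : G.Carrier → ℕ) → CG.Resp g → CR.Σ' (λ x → g (φ x)) ≡ CG.Σ' g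
    reindex = Transfer.transfer R G φ ψ
      (λ x y e → injective (G.trans e (G.sym (φψ y))))
      (λ x y e → G.trans (⟦⟧-cong e) (φψ y))

    hom-sub : ∀ x y → φ (x R.+ R.- y) G.≈ φ x G.+ G.- φ y
    hom-sub x y = G.trans (+-homo x (R.- y)) (G.+-congˡ (-‿homo y))

    Unit→ : ∀ {x} → CR.Unit x → CG.Unit (φ x)
    Unit→ {x} (a , p) = φ a , G.trans (G.sym (*-homo x a)) (G.trans (⟦⟧-cong p) 1#-homo)

    Unit← : ∀ {x} → CG.Unit (φ x) → CR.Unit x
    Unit← {x} (b , p) = ψ b , injective (G.trans (*-homo x (ψ b)) (G.trans (G.*-congˡ (φψ b)) (G.trans p (G.sym 1#-homo))))

    Sq→ : ∀ {x} → CR.Sq x → CG.Sq (φ x)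
    Sq→ {x} (u , uu , e) = φ u , Unit→ uu , G.trans (⟦⟧-cong e) (*-homo u u)

    Sq← : ∀ {x} → CG.Sq (φ x) → CR.Sq x
    Sq← {x} (v , uv , e) = ψ v , Unit← (CG.Unit-resp (G.sym (φψ v)) uv) ,
      injective (G.trans e (G.trans (G.*-cong (G.sym (φψ v)) (G.sym (φψ v))) (G.sym (*-homo (ψ v) (ψ v)))))

    InT→ : ∀ {x} → CR.InT x → CG.InT (φ x)
    InT→ (inj₁ s) = inj₁ (Sq→ s)
    InT→ {x} (inj₂ s) = inj₂ (CG.Sq-resp (-‿homo x) (Sq→ s))

    InT← : ∀ {x} → CG.InT (φ x) → CR.InT x
    InT← (inj₁ s) = inj₁ (Sq← s)
    InT← {x} (inj₂ s) = inj₂ (Sq← (CG.Sq-resp (G.sym (-‿homo x)) s))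

    τφ : ∀ x → CR.τ x ≡ CG.τ (φ x)
    τφ x = ≡trans (CR.τ≡ x) (≡trans (χ-⇔ InT→ InT← (CR.InT? x) (CG.InT? (φ x))) (≡sym (CG.τ≡ (φ x))))

    Δ-transport : (s : G.Carrier → ℕ) → CG.Resp s → CR.Δ (λ x → s (φ x)) ≡ CG.Δ s
    Δ-transport s rs = begin
        CR.Δ (λ x → s (φ x))
          ≡⟨ sumL-cong R.elems (λ x → sumL-cong R.elems (λ y → sumL-cong R.elems (λ z →
               cong₂ _*ℕ_ (rs (hom-sub x y)) (cong₂ _*ℕ_ (rs (hom-sub x z)) (rs (hom-sub y z)))))) ⟩
        CR.Σ' (λ x → CR.Σ' (λ y → CR.Σ' (λ z → T (φ x) (φ y) (φ z))))
          ≡⟨ sumL-cong R.elems (λ x → sumL-cong R.elems (λ y → reindex (T (φ x) (φ y)) T-resp₃)) ⟩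
        CR.Σ' (λ x → CR.Σ' (λ y → CG.Σ' (T (φ x) (φ y))))
          ≡⟨ sumL-cong R.elems (λ x → reindex (λ b → CG.Σ' (T (φ x) b)) (λ e → sumL-cong G.elems (λ c → T-resp₂ e))) ⟩
        CR.Σ' (λ x → CG.Σ' (λ b → CG.Σ' (T (φ x) b)))
          ≡⟨ reindex (λ a → CG.Σ' (λ b → CG.Σ' (T a b))) (λ e → sumL-cong G.elems (λ b → sumL-cong G.elems (λ c → T-resp₁ e))) ⟩
        CG.Δ s ∎
      where
      open Relation.Binary.PropositionalEquality.≡-Reasoning
      T : G.Carrier → G.Carrier → G.Carrier → ℕ
      T a b c = s (a G.+ G.- b) *ℕ (s (a G.+ G.- c) *ℕ s (b G.+ G.- c))
      T-resp₁ : ∀ {a a' b c} → a G.≈ a' → T a b c ≡ T a' b c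
      T-resp₁ {b = b} {c} e = cong₂ _*ℕ_ (rs (G.+-congʳ e)) (cong (_*ℕ s (b G.+ G.- c)) (rs (G.+-congʳ e)))
      T-resp₂ : ∀ {a b b' c} → b G.≈ b' → T a b c ≡ T a b' c
      T-resp₂ {a} {c = c} e = cong₂ _*ℕ_ (rs (G.+-congˡ (G.-‿cong e))) (cong (s (a G.+ G.- c) *ℕ_) (rs (G.+-congʳ e)))
      T-resp₃ : ∀ {a b c c'} → c G.≈ c' → T a b c ≡ T a b c'
      T-resp₃ {a} {b} e = cong (s (a G.+ G.- b) *ℕ_) (cong₂ _*ℕ_ (rs (G.+-congˡ (G.-‿cong e))) (rs (G.+-congˡ (G.-‿cong e))))

    1≉0← : ¬ (G.1# G.≈ G.0#) → ¬ (R.1# R.≈ R.0#)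
    1≉0← n e = n (G.trans (G.sym 1#-homo) (G.trans (⟦⟧-cong e) 0#-homo))

    n3-iso : ¬ (R.1# R.≈ R.0#) → 6 *ℕ n3 R ≡ CG.Δ CG.τ
    n3-iso n = ≡trans (CR.n3≡Δ n) (≡trans (CR.Δ-cong τφ) (Δ-transport CG.τ CG.τ-resp))

module Products where

  open import Defs
  open Sums
  open CayleyGraph
  open import Data.Nat using (ℕ) renaming (_*_ to _*ℕ_)
  open import Data.List using (List; []; _∷_; map; cartesianProduct)
  open import Data.List.Relation.Unary.Any using (Any; here; there)
  import Data.List.Relation.Unary.Any as Any
  import Data.List.Relation.Unary.Any.Properties as AnyP
  open import Data.List.Relation.Unary.All using (All; []; _∷_)
  import Data.List.Relation.Unary.All as All
  import Data.List.Relation.Unary.All.Properties as AllP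
  open import Data.List.Relation.Unary.AllPairs using (AllPairs; []; _∷_)
  import Data.List.Relation.Unary.AllPairs as AllPairs
  import Data.List.Relation.Unary.AllPairs.Properties as APP
  open import Data.Product using (_×_; _,_; proj₁; proj₂)
  open import Relation.Nullary using (¬_)
  open import Relation.Nullary.Decidable using (_×-dec_)
  open import Relation.Binary.PropositionalEquality using (_≡_; refl; cong; cong₂) renaming (sym to ≡sym; trans to ≡trans)
  open import Data.Sum using (inj₁; inj₂)
  import Algebra.Construct.DirectProduct as DP
  open import Data.Nat.Tactic.RingSolver using (solve-∀)

  sum-pairs : {A B : Set} (as : List A) (bs : List B) (f : A × B → ℕ) →
    sumL (cartesianProduct as bs) f ≡ sumL as (λ a → sumL bs (λ b → f (a , b)))
  sum-pairs [] bs f = refl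
  sum-pairs (a ∷ as) bs f = ≡trans (sumL-++ (map (a ,_) bs) (cartesianProduct as bs) f)
    (cong₂ Data.Nat._+_ (sumL-map bs (a ,_) f) (sum-pairs as bs f))

  prodF : FinCommRing → FinCommRing → FinCommRing
  prodF A B = record
    { cring = DP.commutativeRing (FinCommRing.cring A) (FinCommRing.cring B)
    ; _≈?_ = λ { (a , b) (a' , b') → (a A.≈? a') ×-dec (b B.≈? b') }
    ; elems = cartesianProduct A.elems B.elems
    ; complete = λ { (a , b) → comp A.elems (A.complete a) (B.complete b) }
    ; unique = uniq A.elems A.unique
    }
    where
    module A = FinCommRing A
    module B = FinCommRing B
    comp : ∀ {a b} (as : List A.Carrier) → Any (a A.≈_) as → Any (b B.≈_) B.elems →
      Any (λ p → (a A.≈ proj₁ p) × (b B.≈ proj₂ p)) (cartesianProduct as B.elems)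
    comp (a' ∷ as) (here e) ab = AnyP.++⁺ˡ (AnyP.map⁺ (Any.map (λ f → e , f) ab))
    comp (a' ∷ as) (there p) ab = AnyP.++⁺ʳ (map (a' ,_) B.elems) (comp as p ab)
    fst-all : ∀ {P : A.Carrier → Set} (as : List A.Carrier) (bs : List B.Carrier) → All P as → All (λ p → P (proj₁ p)) (cartesianProduct as bs)
    fst-all [] bs [] = []
    fst-all (a ∷ as) bs (pa ∷ pas) = AllP.++⁺ (AllP.map⁺ (All.tabulate (λ _ → pa))) (fst-all as bs pas)
    uniq : ∀ (as : List A.Carrier) → AllPairs (λ x y → ¬ x A.≈ y) as →
      AllPairs (λ p p' → ¬ ((proj₁ p A.≈ proj₁ p') × (proj₂ p B.≈ proj₂ p'))) (cartesianProduct as B.elems)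
    uniq [] [] = []
    uniq (a ∷ as) (na ∷ u) = APP.++⁺ (APP.map⁺ (AllPairs.map (λ n e → n (proj₂ e)) B.unique)) (uniq as u)
      (AllP.map⁺ (All.tabulate (λ {b} _ → All.map (λ n e → n (proj₁ e)) (fst-all as B.elems na))))

  module ProdFacts (A B : FinCommRing) where
    P : FinCommRing
    P = prodF A B
    private
      module A = FinCommRing A
      module B = FinCommRing B
      module P = FinCommRing P
      module CA = Cayley A
      module CB = Cayley B
      module CP = Cayley P

    ΣP : ∀ (f : P.Carrier → ℕ) → CP.Σ' f ≡ CA.Σ' (λ a → CB.Σ' (λ b → f (a , b)))
    ΣP f = sum-pairs A.elems B.elems f

    Σ-sep : ∀ (u : A.Carrier → ℕ) (v : B.Carrier → ℕ) → CP.Σ' (λ p → u (proj₁ p) *ℕ v (proj₂ p)) ≡ CA.Σ' u *ℕ CB.Σ' v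
    Σ-sep u v = ≡trans (ΣP _) (sumL-prod A.elems B.elems u v)

    Unit⇒ : ∀ {a b} → CP.Unit (a , b) → CA.Unit a × CB.Unit b
    Unit⇒ ((c , d) , (e , f)) = (c , e) , (d , f)

    ⇒Unit : ∀ {a b} → CA.Unit a → CB.Unit b → CP.Unit (a , b)
    ⇒Unit (c , e) (d , f) = (c , d) , (e , f)

    Sq⇒ : ∀ {a b} → CP.Sq (a , b) → CA.Sq a × CB.Sq b
    Sq⇒ ((u , v) , uu , (e , f)) = (u , proj₁ (Unit⇒ uu) , e) , (v , proj₂ (Unit⇒ uu) , f)

    ⇒Sq : ∀ {a b} → CA.Sq a → CB.Sq b → CP.Sq (a , b)
    ⇒Sq (u , uu , e) (v , uv , f) = (u , v) , ⇒Unit uu uv , (e , f)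

    χSq : ∀ a b → χ (CP.Sq? (a , b)) ≡ χ (CA.Sq? a) *ℕ χ (CB.Sq? b)
    χSq a b = ≡trans (χ-⇔ (λ s → Sq⇒ s) (λ { (s , t) → ⇒Sq s t }) (CP.Sq? (a , b)) (CA.Sq? a ×-dec CB.Sq? b)) (χ-× (CA.Sq? a) (CB.Sq? b))

    τ-prod : CB.Sq (B.- B.1#) → ∀ a b → CP.τ (a , b) ≡ CA.τ a *ℕ χ (CB.Sq? b)
    τ-prod s1 a b = ≡trans (CP.τ≡ (a , b)) (≡trans (χ-⇔ to fro (CP.InT? (a , b)) (CA.InT? a ×-dec CB.Sq? b))
       (≡trans (χ-× (CA.InT? a) (CB.Sq? b)) (cong (_*ℕ χ (CB.Sq? b)) (≡sym (CA.τ≡ a)))))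
      where
      to : CP.InT (a , b) → CA.InT a × CB.Sq b
      to (inj₁ s) = inj₁ (proj₁ (Sq⇒ s)) , proj₂ (Sq⇒ s)
      to (inj₂ s) = inj₂ (proj₁ (Sq⇒ s)) , CB.Sq-unneg s1 (proj₂ (Sq⇒ s))
      fro : CA.InT a × CB.Sq b → CP.InT (a , b)
      fro (inj₁ s , t) = inj₁ (⇒Sq s t)
      fro (inj₂ s , t) = inj₂ (⇒Sq s (CB.Sq-neg s1 t))

    Δ-prod : ∀ (f : A.Carrier → ℕ) (g : B.Carrier → ℕ) → CP.Δ (λ p → f (proj₁ p) *ℕ g (proj₂ p)) ≡ CA.Δ f *ℕ CB.Δ g
    Δ-prod f g = begin
        CP.Σ' (λ p → CP.Σ' (λ p' → CP.Σ' (λ p'' →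
          (f (a p p') *ℕ g (b p p')) *ℕ ((f (a p p'') *ℕ g (b p p'')) *ℕ (f (a p' p'') *ℕ g (b p' p''))))))
          ≡⟨ sumL-cong P.elems (λ p → sumL-cong P.elems (λ p' → sumL-cong P.elems (λ p'' → separate p p' p''))) ⟩
        CP.Σ' (λ p → CP.Σ' (λ p' → CP.Σ' (λ p'' → TA (proj₁ p) (proj₁ p') (proj₁ p'') *ℕ TB (proj₂ p) (proj₂ p') (proj₂ p''))))
          ≡⟨ sumL-cong P.elems (λ p → sumL-cong P.elems (λ p' → Σ-sep _ _)) ⟩
        CP.Σ' (λ p → CP.Σ' (λ p' → CA.Σ' (TA (proj₁ p) (proj₁ p')) *ℕ CB.Σ' (TB (proj₂ p) (proj₂ p'))))
          ≡⟨ sumL-cong P.elems (λ p → Σ-sep _ _) ⟩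
        CP.Σ' (λ p → CA.Σ' (λ a' → CA.Σ' (TA (proj₁ p) a')) *ℕ CB.Σ' (λ b' → CB.Σ' (TB (proj₂ p) b')))
          ≡⟨ Σ-sep _ _ ⟩
        CA.Δ f *ℕ CB.Δ g ∎
      where
      open Relation.Binary.PropositionalEquality.≡-Reasoning
      a : P.Carrier → P.Carrier → A.Carrier
      a p p' = proj₁ p A.+ A.- proj₁ p'
      b : P.Carrier → P.Carrier → B.Carrier
      b p p' = proj₂ p B.+ B.- proj₂ p'
      TA : A.Carrier → A.Carrier → A.Carrier → ℕ
      TA x y z = f (x A.+ A.- y) *ℕ (f (x A.+ A.- z) *ℕ f (y A.+ A.- z))
      TB : B.Carrier → B.Carrier → B.Carrier → ℕ
      TB x y z = g (x B.+ B.- y) *ℕ (g (x B.+ B.- z) *ℕ g (y B.+ B.- z))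
      rearrange : ∀ p q r s t u → (p *ℕ q) *ℕ ((r *ℕ s) *ℕ (t *ℕ u)) ≡ (p *ℕ (r *ℕ t)) *ℕ (q *ℕ (s *ℕ u))
      rearrange = solve-∀
      separate : ∀ p p' p'' →
        (f (a p p') *ℕ g (b p p')) *ℕ ((f (a p p'') *ℕ g (b p p'')) *ℕ (f (a p' p'') *ℕ g (b p' p'')))
          ≡ TA (proj₁ p) (proj₁ p') (proj₁ p'') *ℕ TB (proj₂ p) (proj₂ p') (proj₂ p'')
      separate p p' p'' = rearrange (f (a p p')) (g (b p p')) (f (a p p'')) (g (b p p'')) (f (a p' p'')) (g (b p' p''))

    Δτ-prod : CB.Sq (B.- B.1#) → CP.Δ CP.τ ≡ CA.Δ CA.τ *ℕ CB.Δ (λ b → χ (CB.Sq? b))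
    Δτ-prod s1 = ≡trans (CP.Δ-cong (λ p → τ-prod s1 (proj₁ p) (proj₂ p))) (Δ-prod CA.τ (λ b → χ (CB.Sq? b)))

-- Every nonunit of a finite ring lies in a maximal ideal (in the sense of
-- Defs): starting from the principal ideal (y), keep adjoining an element
-- x with 1 ∉ I + R x; the size of I strictly increases, so this stops,
-- and when it stops I is maximal.
module MaximalIdeals where

  open import Defs
  open Sums
  open Enumeration
  open RingFacts
  open Booleans
  open import Data.Nat using (ℕ; zero; suc; _≤_; _<_; z≤n; s≤s) renaming (_+_ to _+ℕ_)
  import Data.Nat.Properties as N
  open import Data.Bool using (true; false)
  import Data.Bool as B
  open import Data.List.Relation.Unary.Any using (Any; any?)
  import Data.List.Relation.Unary.Any as Any
  import Data.List.Relation.Unary.All as All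
  open import Data.List.Relation.Unary.All.Properties.Core using (¬Any⇒All¬)
  open import Data.Product using (Σ; _×_; _,_; ∃)
  open import Relation.Nullary using (Dec; yes; no; ¬_; does)
  open import Relation.Nullary.Decidable using (_×-dec_)
  open import Relation.Binary.PropositionalEquality using (_≡_; refl; cong; subst) renaming (sym to ≡sym; trans to ≡trans)
  open import Data.Empty using (⊥-elim)
  open import Data.Sum using (_⊎_; inj₁; inj₂)

  module Extension (F : FinCommRing) where
    open FinCommRing F using (Carrier; _≈_; _≈?_; elems; complete; 0#; 1#; +-cong; *-congˡ; *-congʳ; *-comm; *-identityʳ; +-identityˡ; zeroʳ)
      renaming (_+_ to _+r_; _*_ to _*r_; refl to ≈refl; sym to ≈sym; trans to ≈trans)
    open RL (FinCommRing.cring F)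
    open Over F

    cnt : Subset F → ℕ
    cnt I = Σ' (λ x → ind (I x))

    cnt≤card : ∀ I → cnt I ≤ Σ' (λ _ → 1)
    cnt≤card I = sumL-mono elems (λ x → ind≤1 (I x))

    JP : Subset F → Carrier → Carrier → Set
    JP I x z = ∃ λ a → ∃ λ r → I a ≡ true × z ≈ a +r r *r x

    Jdec : (I : Subset F) (x z : Carrier) → Dec (Any (λ a → Any (λ r → (I a ≡ true) × (z ≈ a +r r *r x)) elems) elems)
    Jdec I x z = any? (λ a → any? (λ r → (I a B.≟ true) ×-dec (z ≈? (a +r r *r x))) elems) elems

    J : Subset F → Carrier → Subset F
    J I x z = does (Jdec I x z)

    J⇒ : ∀ I x z → J I x z ≡ true → JP I x z
    J⇒ I x z e with any⇒∃ (does-true (Jdec I x z) e)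
    ... | a , an with any⇒∃ an
    ... | r , p , q = a , r , p , q

    ⇒J : ∀ I → IsIdeal F I → ∀ x z → JP I x z → J I x z ≡ true
    ⇒J I isI x z (a , r , pa , e) = true-does (Jdec I x z)
       (Any.map (λ {a'} aa' → Any.map (λ {r'} rr' → ≡trans (≡sym (IsIdeal.resp isI aa')) pa , ≈trans e (+-cong aa' (*-congʳ rr'))) (complete r)) (complete a))

    J-ideal : ∀ I → IsIdeal F I → ∀ x → IsIdeal F (J I x)
    J-ideal I isI x = record
      { resp = λ {z} {z'} e → bool-ext _ _
          (λ p → ⇒J I isI x z' (let (a , r , pa , q) = J⇒ I x z p in a , r , pa , ≈trans (≈sym e) q))
          (λ p → ⇒J I isI x z (let (a , r , pa , q) = J⇒ I x z' p in a , r , pa , ≈trans e q))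
      ; zero∈ = ⇒J I isI x 0# (0# , 0# , IsIdeal.zero∈ isI , 0+0*x x)
      ; +-closed = λ z w pz pw → let (a , r , pa , qa) = J⇒ I x z pz ; (b , s , pb , qb) = J⇒ I x w pw in
          ⇒J I isI x (z +r w) (a +r b , r +r s , IsIdeal.+-closed isI a b pa pb , ≈trans (+-cong qa qb) (ideal-+ a r b s x))
      ; *-closed = λ t z pz → let (a , r , pa , qa) = J⇒ I x z pz in
          ⇒J I isI x (t *r z) (t *r a , t *r r , IsIdeal.*-closed isI t a pa , ≈trans (*-congˡ qa) (ideal-* t a r x))
      }

    I⊆J : ∀ I → IsIdeal F I → ∀ x z → I z ≡ true → J I x z ≡ true
    I⊆J I isI x z p = ⇒J I isI x z (z , 0# , p , a≈a+0x z x)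

    x∈J : ∀ I → IsIdeal F I → ∀ x → J I x x ≡ true
    x∈J I isI x = ⇒J I isI x x (0# , 1# , IsIdeal.zero∈ isI , x≈0+1x x)

    J⊆ : ∀ I x K → IsIdeal F K → (∀ z → I z ≡ true → K z ≡ true) → K x ≡ true → ∀ z → J I x z ≡ true → K z ≡ true
    J⊆ I x K isK sub kx z p with J⇒ I x z p
    ... | a , r , pa , q = ≡trans (IsIdeal.resp isK q) (IsIdeal.+-closed isK a (r *r x) (sub a pa) (IsIdeal.*-closed isK r x kx))

    resp-ind : ∀ I → IsIdeal F I → Resp (λ z → ind (I z))
    resp-ind I isI e = cong ind (IsIdeal.resp isI e)

    one⇒all : ∀ K → IsIdeal F K → K 1# ≡ true → ∀ w → K w ≡ true
    one⇒all K isK k1 w = ≡trans (IsIdeal.resp isK (≈sym (*-identityʳ w))) (IsIdeal.*-closed isK w 1# k1)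

    record MaxAbove (I : Subset F) : Set where
      field
        Nm : Subset F
        isMax : IsMaximalIdeal F Nm
        above : ∀ z → I z ≡ true → Nm z ≡ true

    maximal-if-stuck : ∀ I → IsIdeal F I → I 1# ≡ false →
      ¬ Any (λ x → (I x ≡ false) × (J I x 1# ≡ false)) elems → IsMaximalIdeal F I
    maximal-if-stuck I isI i1 stuck = isI , i1 , decide
      where
      decide : ∀ K → IsIdeal F K → (∀ x → I x ≡ true → K x ≡ true) →
        (∀ x → K x ≡ true → I x ≡ true) ⊎ (∀ x → K x ≡ true)
      decide K isK sub with any? (λ z → (K z B.≟ true) ×-dec (I z B.≟ false)) elems
      ... | no nb = inj₁ (λ w kw → not-false (I w) (λ iw → nb (∃⇒any K∖I-resp (w , kw , iw))))
        where
        K∖I-resp : RespP (λ z → K z ≡ true × I z ≡ false)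
        K∖I-resp e (p , q) = ≡trans (≡sym (IsIdeal.resp isK e)) p , ≡trans (≡sym (IsIdeal.resp isI e)) q
      ... | yes a with All.lookupAny (¬Any⇒All¬ elems stuck) a
      ...   | not-stuck , kz , iz =
        inj₂ (one⇒all K isK (J⊆ I _ K isK sub kz 1# (not-false _ (λ jf → not-stuck (iz , jf)))))

    J-grows : ∀ I → IsIdeal F I → ∀ x → I x ≡ false → cnt I < cnt (J I x)
    J-grows I isI x ix = sum-strict (λ z → ind (I z)) (λ z → ind (J I x z)) (resp-ind I isI) (resp-ind (J I x) (J-ideal I isI x))
      (λ z → mono z (I z) refl) x (subst (λ b → ind b < ind (J I x x)) (≡sym ix) (subst (λ b → 0 < ind b) (≡sym (x∈J I isI x)) (s≤s z≤n)))
      where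
      mono : ∀ z b → I z ≡ b → ind b ≤ ind (J I x z)
      mono z false _ = z≤n
      mono z true e = N.≤-reflexive (cong ind (≡sym (I⊆J I isI x z e)))

    extend : (n : ℕ) (I : Subset F) → IsIdeal F I → I 1# ≡ false → Σ' (λ _ → 1) < cnt I +ℕ n → MaxAbove I
    extend zero I isI i1 lt = ⊥-elim (N.<⇒≱ lt (N.≤-trans (N.≤-reflexive (N.+-identityʳ (cnt I))) (cnt≤card I)))
    extend (suc n) I isI i1 lt with any? (λ x → (I x B.≟ false) ×-dec (J I x 1# B.≟ false)) elems
    ... | no stuck = record { Nm = I ; isMax = maximal-if-stuck I isI i1 stuck ; above = λ z p → p }
    ... | yes a with any⇒∃ a
    ...   | x , ix , j1 = record { Nm = MaxAbove.Nm next ; isMax = MaxAbove.isMax next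
                                 ; above = λ z p → MaxAbove.above next z (I⊆J I isI x z p) }
      where
      next : MaxAbove (J I x)
      next = extend n (J I x) (J-ideal I isI x) j1
        (N.<-≤-trans lt (N.≤-trans (N.≤-reflexive (N.+-suc (cnt I) n)) (N.+-monoˡ-≤ n (J-grows I isI x ix))))

    zeroI : Subset F
    zeroI z = does (z ≈? 0#)

    zeroI-ideal : IsIdeal F zeroI
    zeroI-ideal = record
      { resp = λ {z} {z'} e → bool-ext _ _ (λ p → true-does (z' ≈? 0#) (≈trans (≈sym e) (does-true (z ≈? 0#) p)))
                                       (λ p → true-does (z ≈? 0#) (≈trans e (does-true (z' ≈? 0#) p)))
      ; zero∈ = true-does (0# ≈? 0#) ≈refl
      ; +-closed = λ a b pa pb → true-does ((a +r b) ≈? 0#) (≈trans (+-cong (does-true (a ≈? 0#) pa) (does-true (b ≈? 0#) pb)) (+-identityˡ 0#))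
      ; *-closed = λ r a pa → true-does ((r *r a) ≈? 0#) (≈trans (*-congˡ (does-true (a ≈? 0#) pa)) (zeroʳ r))
      }

    nonunit-in-max : ∀ y → ¬ Unit y → Σ (Subset F) λ N → IsMaximalIdeal F N × N y ≡ true
    nonunit-in-max y nu = MaxAbove.Nm N , MaxAbove.isMax N , MaxAbove.above N y (x∈J zeroI zeroI-ideal y)
      where
      y∉1 : J zeroI y 1# ≡ false
      y∉1 = not-true _ (λ p → let (a , r , pa , q) = J⇒ zeroI y 1# p in
             nu (r , ≈trans (*-comm y r) (≈sym (≈trans q (≈trans (+-cong (does-true (a ≈? 0#) pa) ≈refl) (+-identityˡ _))))))
      N : MaxAbove (J zeroI y)
      N = extend (suc (Σ' (λ _ → 1))) (J zeroI y) (J-ideal zeroI zeroI-ideal y) y∉1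
            (N.m≤n+m (suc (Σ' (λ _ → 1))) (cnt (J zeroI y)))

-- Parity of an involution: if σ is an involution of a finite (≈-closed)
-- set S, then |S| ≡ |Fix σ| (mod 2), since the non-fixed points pair up.
module Involutions where

  open import Defs
  open Sums
  open Enumeration
  open import Data.Nat using (ℕ; _+_; _*_)
  import Data.Nat.Properties as N
  open import Data.Product using (_×_; _,_; ∃)
  open import Relation.Nullary using (Dec; ¬_)
  open import Relation.Nullary.Decidable using (_×-dec_; ¬?)
  open import Relation.Binary.PropositionalEquality using (_≡_; cong; sym; trans)

  module _ (F : FinCommRing) where
    open FinCommRing F using (Carrier; _≈_; _≈?_; elems) renaming (sym to ≈sym; trans to ≈trans)
    open Over F

    parity : (S : Carrier → Set) (S? : ∀ x → Dec (S x)) → RespP S →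
      (σ : Carrier → Carrier) → (∀ {x y} → x ≈ y → σ x ≈ σ y) →
      (∀ x → S x → σ (σ x) ≈ x) → (∀ x → S x → S (σ x)) →
      ∃ λ k → Σ' (λ x → χ (S? x)) ≡ Σ' (λ x → χ (S? x ×-dec (σ x ≈? x))) + 2 * k
    parity S S? Sresp σ σresp σσ σS = pairSum h elems , (begin
        Σ' (λ x → χ (S? x)) ≡⟨ sumL-cong elems (λ x → χ-split (S? x) (σ x ≈? x)) ⟩
        Σ' (λ x → χ (S? x ×-dec (σ x ≈? x)) + χ (Moved? x)) ≡⟨ sumL-+ elems _ _ ⟩
        Fix + Σ' (λ x → χ (Moved? x)) ≡⟨ cong (Fix +_) (sym (sumL-cong elems row)) ⟩
        Fix + Σ' (λ x → Σ' (h x)) ≡⟨ cong (Fix +_) (pairSum-lemma h h-sym h-diag elems) ⟩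
        Fix + 2 * pairSum h elems ∎)
      where
      open Relation.Binary.PropositionalEquality.≡-Reasoning
      Fix : ℕ
      Fix = Σ' (λ x → χ (S? x ×-dec (σ x ≈? x)))
      Cycle : Carrier → Carrier → Set
      Cycle x y = (S x × S y) × (σ x ≈ y × ¬ (σ x ≈ x))
      Cycle? : ∀ x y → Dec (Cycle x y)
      Cycle? x y = (S? x ×-dec S? y) ×-dec ((σ x ≈? y) ×-dec ¬? (σ x ≈? x))
      h : Carrier → Carrier → ℕ
      h x y = χ (Cycle? x y)
      Cycle-sym : ∀ x y → Cycle x y → Cycle y x
      Cycle-sym x y ((sx , sy) , e , ne) = (sy , sx) , σyx , λ f → ne (≈trans e (≈sym (≈trans (≈sym σyx) f)))
        where
        σyx : σ y ≈ x
        σyx = ≈trans (σresp (≈sym e)) (σσ x sx)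
      h-sym : ∀ x y → h x y ≡ h y x
      h-sym x y = χ-⇔ (Cycle-sym x y) (Cycle-sym y x) (Cycle? x y) (Cycle? y x)
      h-diag : ∀ x → h x x ≡ 0
      h-diag x = χ-no (Cycle? x x) (λ { (_ , e , ne) → ne e })
      Moved? : ∀ x → Dec (S x × ¬ (σ x ≈ x))
      Moved? x = S? x ×-dec ¬? (σ x ≈? x)
      row : ∀ x → Σ' (h x) ≡ χ (Moved? x)
      row x = begin
          Σ' (h x) ≡⟨ sumL-cong elems (λ y → trans (χ-⇔ (λ { ((sx , sy) , e , ne) → (sx , ne) , e })
                                                          (λ { ((sx , ne) , e) → (sx , Sresp e (σS x sx)) , e , ne })
                                                          (Cycle? x y) (Moved? x ×-dec (σ x ≈? y)))
                                                   (χ-× (Moved? x) (σ x ≈? y))) ⟩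
          Σ' (λ y → χ (Moved? x) * χ (σ x ≈? y)) ≡⟨ sumL-*ˡ elems (χ (Moved? x)) _ ⟩
          χ (Moved? x) * Σ' (λ y → χ (σ x ≈? y)) ≡⟨ cong (χ (Moved? x) *_) (δ (σ x)) ⟩
          χ (Moved? x) * 1 ≡⟨ N.*-identityʳ _ ⟩
          χ (Moved? x) ∎

-- Each
-- class is represented by the first element of the enumeration in it.
module Cosets where

  open import Defs
  open Sums
  open Enumeration
  open Booleans using (ind; bool-ext; χ-ind)
  open import Data.Nat using (ℕ; _*_)
  open import Data.Bool using (Bool; true)
  import Data.Bool as B
  open import Data.List.Relation.Unary.Any using (Any)
  import Data.List.Relation.Unary.Any as Any
  open import Data.Product using (_×_; _,_)
  open import Relation.Nullary.Decidable using (_×-dec_)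
  open import Relation.Binary.PropositionalEquality using (_≡_; cong; subst; sym; trans)

  module _ (F : FinCommRing) where
    open FinCommRing F using (Carrier; _≈_; _≈?_; elems; complete) renaming (sym to ≈sym)
    open Over F

    module Classes (E : Carrier → Carrier → Bool) (Erefl : ∀ x → E x x ≡ true)
             (Esym : ∀ {x y} → E x y ≡ true → E y x ≡ true)
             (Etrans : ∀ {x y z} → E x y ≡ true → E y z ≡ true → E x z ≡ true)
             (Eresp : ∀ {x y y'} → y ≈ y' → E x y ≡ E x y')
             (K : ℕ) (Ksize : ∀ y → Σ' (λ x → ind (E x y)) ≡ K) where

      ρ : Carrier → Carrier
      ρ x = firstOr (E x) elems x

      anyE : ∀ x → Any (λ z → E x z ≡ true) elems
      anyE x = Any.map (λ {z} e → trans (sym (Eresp e)) (Erefl x)) (complete x)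

      ρ-E : ∀ x → E x (ρ x) ≡ true
      ρ-E x = fo-sat (E x) elems x (anyE x)

      ρ-class : ∀ {x y} → E x y ≡ true → ρ x ≡ ρ y
      ρ-class {x} {y} e = fo-ext (E x) (E y) elems x y
        (λ z → bool-ext _ _ (λ p → Etrans (Esym e) p) (λ p → Etrans e p)) (anyE x)

      rep : Carrier → ℕ
      rep y = χ (ρ y ≈? y)

      key : ∀ x y → χ (y ≈? ρ x) ≡ rep y * ind (E x y)
      key x y = trans (χ-⇔ to fro (y ≈? ρ x) ((ρ y ≈? y) ×-dec (E x y B.≟ true)))
                  (trans (χ-× (ρ y ≈? y) (E x y B.≟ true)) (cong (rep y *_) (χ-ind (E x y))))
        where
        to : y ≈ ρ x → (ρ y ≈ y) × (E x y ≡ true)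
        to e = subst (λ w → w ≈ y) (ρ-class exy) (≈sym e) , exy
          where
          exy : E x y ≡ true
          exy = trans (sym (Eresp (≈sym e))) (ρ-E x)
        fro : (ρ y ≈ y) × (E x y ≡ true) → y ≈ ρ x
        fro (r , e) = ≈sym (subst (λ w → w ≈ y) (sym (ρ-class e)) r)

      lagrange : Σ' (λ _ → 1) ≡ Σ' rep * K
      lagrange = begin
          Σ' (λ _ → 1) ≡⟨ sumL-cong elems (λ x → sym (δ' (ρ x))) ⟩
          Σ' (λ x → Σ' (λ y → χ (y ≈? ρ x))) ≡⟨ sumL-cong elems (λ x → sumL-cong elems (key x)) ⟩
          Σ' (λ x → Σ' (λ y → rep y * ind (E x y))) ≡⟨ sumL-swap elems elems _ ⟩
          Σ' (λ y → Σ' (λ x → rep y * ind (E x y))) ≡⟨ sumL-cong elems (λ y → sumL-*ˡ elems (rep y) _) ⟩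
          Σ' (λ y → rep y * Σ' (λ x → ind (E x y))) ≡⟨ sumL-cong elems (λ y → cong (rep y *_) (Ksize y)) ⟩
          Σ' (λ y → rep y * K) ≡⟨ sumL-*ʳ elems K rep ⟩
          Σ' rep * K ∎
        where open Relation.Binary.PropositionalEquality.≡-Reasoning

module LocalRing where

  open import Defs
  open Sums
  open Booleans
  open CayleyGraph
  open import Data.Nat using (ℕ; _≤_) renaming (_+_ to _+ℕ_)
  import Data.Nat.Properties as N
  open import Data.Bool using (true; false; T?)
  open import Data.Product using (_,_; proj₁; proj₂)
  open import Relation.Nullary using (yes; no; ¬_)
  open import Relation.Binary.PropositionalEquality using (_≡_; refl; cong) renaming (sym to ≡sym; trans to ≡trans)
  open import Data.Empty using (⊥-elim)
  open import Data.Sum using (_⊎_; inj₁; inj₂)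

  module Basics (F : FinCommRing) (Mx : Subset F) (loc : IsLocalWithMax F Mx) where
    open FinCommRing F public using (Carrier; _≈_; _≈?_; elems; complete; unique; 0#; 1#; +-cong; +-congˡ; +-congʳ; *-cong; *-congˡ; *-congʳ; *-comm; *-assoc; +-comm; +-assoc; *-identityʳ; *-identityˡ; +-identityʳ; +-identityˡ; -‿cong; -‿inverseʳ; -‿inverseˡ; distribʳ; distribˡ; zeroˡ; zeroʳ; setoid)
      renaming (_+_ to _+r_; _*_ to _*r_; -_ to -r_; refl to ≈refl; sym to ≈sym; trans to ≈trans)
    open Cayley F public
    open MaximalIdeals.Extension F using (nonunit-in-max)

    isI : IsIdeal F Mx
    isI = proj₁ (proj₁ loc)
    M1 : Mx 1# ≡ false
    M1 = proj₁ (proj₂ (proj₁ loc))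

    Mresp : ∀ {x y} → x ≈ y → Mx x ≡ Mx y
    Mresp = IsIdeal.resp isI
    M0 : Mx 0# ≡ true
    M0 = IsIdeal.zero∈ isI
    M+ : ∀ {a b} → Mx a ≡ true → Mx b ≡ true → Mx (a +r b) ≡ true
    M+ {a} {b} = IsIdeal.+-closed isI a b
    M* : ∀ r {a} → Mx a ≡ true → Mx (r *r a) ≡ true
    M* r {a} = IsIdeal.*-closed isI r a
    Mneg : ∀ {a} → Mx a ≡ true → Mx (-r a) ≡ true
    Mneg {a} p = ≡trans (Mresp (≈sym (-1*x≈-x a))) (M* (-r 1#) p)
    M≈ : ∀ {a b} → a ≈ b → Mx a ≡ true → Mx b ≡ true
    M≈ e p = ≡trans (≡sym (Mresp e)) p

    unit⇒¬M : ∀ {x} → Unit x → Mx x ≡ false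
    unit⇒¬M {x} (y , p) = not-true _ (λ mx → f≢t (≡trans (≡sym M1) (M≈ (≈trans (*-comm y x) p) (M* y mx))))

    -- a nonunit lies in some maximal ideal, which must be M
    ¬M⇒unit : ∀ {x} → Mx x ≡ false → Unit x
    ¬M⇒unit {x} mf with Unit? x
    ... | yes u = u
    ... | no nu with nonunit-in-max x nu
    ...   | N , isMax , Nx = ⊥-elim (f≢t (≡trans (≡sym mf) (≡trans (≡sym (proj₂ loc N isMax x)) Nx)))

    ¬unit⇒M : ∀ {x} → ¬ Unit x → Mx x ≡ true
    ¬unit⇒M {x} nu = not-false (Mx x) (λ mf → nu (¬M⇒unit mf))

    unit-or-M : ∀ x → Unit x ⊎ Mx x ≡ true
    unit-or-M x with Unit? x
    ... | yes u = inj₁ u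
    ... | no nu = inj₂ (¬unit⇒M nu)

    1≉0 : ¬ (1# ≈ 0#)
    1≉0 e = f≢t (≡trans (≡sym M1) (M≈ (≈sym e) M0))

    m : ℕ
    m = Σ' (λ x → ind (Mx x))

    indM-resp : Resp (λ x → ind (Mx x))
    indM-resp e = cong ind (Mresp e)

    U+M : ∀ x → U x +ℕ ind (Mx x) ≡ 1
    U+M x with Unit? x
    ... | yes u rewrite unit⇒¬M u = refl
    ... | no nu rewrite ¬unit⇒M nu = refl

    N≡units+m : Nn ≡ units +ℕ m
    N≡units+m = ≡trans (sumL-cong elems (λ x → ≡sym (U+M x))) (sumL-+ elems U (λ x → ind (Mx x)))

    subsetCard≡m : subsetCard F Mx ≡ m
    subsetCard≡m = ≡trans (length-filter (λ x → T? (Mx x)) elems) (sumL-cong elems (λ x → χT (Mx x)))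

    m>0 : 1 ≤ m
    m>0 = N.≤-trans (N.≤-reflexive (cong ind (≡sym M0))) (le-sum (λ x → ind (Mx x)) indM-resp 0#)

module LocalOdd where

  open import Defs
  open Sums
  open Booleans
  open LocalRing
  open Cosets
  open Involutions
  open import Data.Nat using (ℕ; suc; >-nonZero) renaming (_+_ to _+ℕ_; _*_ to _*ℕ_)
  import Data.Nat.Properties as N
  open import Data.Bool using (Bool; true; false)
  import Data.Bool as B
  open import Data.Product using (_×_; _,_; ∃)
  open import Relation.Nullary using (Dec; yes; no; ¬_)
  open import Relation.Nullary.Decidable using (_×-dec_; _⊎-dec_)
  open import Relation.Binary.PropositionalEquality using (_≡_; cong; cong₂) renaming (sym to ≡sym; trans to ≡trans)
  open import Data.Empty using (⊥; ⊥-elim)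
  open import Data.Sum using (_⊎_; inj₁; inj₂)

  module Odd (F : FinCommRing) (Mx : Subset F) (loc : IsLocalWithMax F Mx)
             (q : ℕ) (hq : q *ℕ subsetCard F Mx ≡ card F) (j : ℕ) (qj : q ≡ suc (2 *ℕ j)) where
    open Basics F Mx loc public
    open FinCommRing F using () renaming (reflexive to ≈reflexive)

    E : Carrier → Carrier → Bool
    E x y = Mx (x +r -r y)

    E-≈ : ∀ {a b} → a ≈ b → E a b ≡ true
    E-≈ {a} {b} e = M≈ (≈sym (≈trans (+-congˡ (-‿cong (≈sym e))) (-‿inverseʳ a))) M0

    Esym : ∀ {x y} → E x y ≡ true → E y x ≡ true
    Esym {x} {y} p = M≈ (⁻¹-anti-homo‿- x y) (Mneg p)

    Etrans : ∀ {x y z} → E x y ≡ true → E y z ≡ true → E x z ≡ true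
    Etrans {x} {y} {z} p r = M≈ (telescope x y z) (M+ p r)

    Eresp : ∀ {x y y'} → y ≈ y' → E x y ≡ E x y'
    Eresp e = Mresp (+-congˡ (-‿cong e))

    coset-size : ∀ y → Σ' (λ x → ind (E x y)) ≡ m
    coset-size y = tr-add (-r y) (λ x → ind (Mx x)) indM-resp

    open Classes F E (λ x → E-≈ ≈refl) Esym Etrans Eresp m coset-size using (ρ; ρ-E; ρ-class; rep; lagrange)

    q≡cosets : q ≡ Σ' rep
    q≡cosets = N.*-cancelʳ-≡ q (Σ' rep) m {{>-nonZero m>0}}
      (≡trans (cong (q *ℕ_) (≡sym subsetCard≡m)) (≡trans hq (≡trans card≡N lagrange)))

    -- if 2 ∈ M, translation by 1 is a fixed-point-free involution of the
    -- cosets, so their number q would be even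
    two∉M : Mx two ≡ false
    two∉M = not-true (Mx two) 2∈M⇒q-even
      where
      IsRep : Carrier → Set
      IsRep y = ρ y ≈ y
      IsRep? : ∀ y → Dec (IsRep y)
      IsRep? y = ρ y ≈? y
      IsRep-resp : RespP IsRep
      IsRep-resp e s = ≈trans (≈reflexive (ρ-class (E-≈ (≈sym e)))) (≈trans s e)
      σ : Carrier → Carrier
      σ y = ρ (y +r 1#)
      σ-resp : ∀ {x y} → x ≈ y → σ x ≈ σ y
      σ-resp e = ≈reflexive (ρ-class (E-≈ (+-congʳ e)))
      σ-rep : ∀ y → IsRep y → IsRep (σ y)
      σ-rep y _ = ≈reflexive (ρ-class (Esym (ρ-E (y +r 1#))))
      σσ : Mx two ≡ true → ∀ y → IsRep y → σ (σ y) ≈ y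
      σσ m2 y s = ≈trans (≈reflexive (ρ-class back)) s
        where
        back : E (ρ (y +r 1#) +r 1#) y ≡ true
        back = M≈ (≈sym (shift-lemma (ρ (y +r 1#)) y)) (M+ (Esym (ρ-E (y +r 1#))) m2)
      no-fixed-point : ∀ y → χ (IsRep? y ×-dec (σ y ≈? y)) ≡ 0
      no-fixed-point y = χ-no (IsRep? y ×-dec (σ y ≈? y))
        (λ { (_ , f) → f≢t (≡trans (≡sym M1) (M≈ (≈trans (+-congʳ (+-comm y 1#)) (add-sub 1# y)) (≡trans (≡sym (Eresp f)) (ρ-E (y +r 1#))))) })
      2∈M⇒q-even : Mx two ≡ true → ⊥
      2∈M⇒q-even m2 with parity F IsRep IsRep? IsRep-resp σ σ-resp (σσ m2) σ-rep
      ... | k , cosets≡ = N.even≢odd k j (≡trans (≡sym cosets≡k) (≡trans (≡sym q≡cosets) qj))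
        where
        cosets≡k : Σ' rep ≡ 2 *ℕ k
        cosets≡k = ≡trans cosets≡ (cong (_+ℕ 2 *ℕ k) (≡trans (sumL-cong elems no-fixed-point) (sumL-0 elems)))

    two-unit : Unit two
    two-unit = ¬M⇒unit two∉M

    neg≈⇒0 : ∀ {x} → -r x ≈ x → x ≈ 0#
    neg≈⇒0 {x} e = unit-cancel two-unit (≈trans (two*x x) (≈trans (+-congˡ (≈sym e)) (-‿inverseʳ x)))

    unit≉neg : ∀ {v} → Unit v → ¬ (v ≈ -r v)
    unit≉neg u e = 1≉0⇒unit≉0 1≉0 u (neg≈⇒0 (≈sym e))

    -- x ↦ -x is an involution of M with the single fixed point 0
    m-odd : ∃ λ k → m ≡ suc (2 *ℕ k)
    m-odd = from-parity (parity F InM InM? M≈ -r_ -‿cong (λ x _ → -‿involutive x) (λ x → Mneg))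
      where
      InM : Carrier → Set
      InM x = Mx x ≡ true
      InM? : ∀ x → Dec (InM x)
      InM? x = Mx x B.≟ true
      only-zero : Σ' (λ x → χ (InM? x ×-dec ((-r x) ≈? x))) ≡ 1
      only-zero = ≡trans (sumL-cong elems (λ x → χ-⇔ (λ { (_ , e) → neg≈⇒0 e })
                            (λ e → M≈ (≈sym e) M0 , ≈trans (-‿cong e) (≈trans -0#≈0# (≈sym e)))
                            (InM? x ×-dec ((-r x) ≈? x)) (x ≈? 0#)))
                         (δ' 0#)
      from-parity : (∃ λ k → Σ' (λ x → χ (InM? x)) ≡ Σ' (λ x → χ (InM? x ×-dec ((-r x) ≈? x))) +ℕ 2 *ℕ k) →
        ∃ λ k → m ≡ suc (2 *ℕ k)
      from-parity (k , m≡) = k , ≡trans (sumL-cong elems (λ x → ≡sym (χ-ind (Mx x)))) (≡trans m≡ (cong (_+ℕ 2 *ℕ k) only-zero))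

    sq-inj : ∀ {u v} → Unit u → Unit v → u *r u ≈ v *r v → (u ≈ v) ⊎ (u ≈ -r v)
    sq-inj {u} {v} uu uv e with unit-or-M (u +r -r v)
    ... | inj₁ ud = inj₂ (+-inverseˡ-unique u v (unit-cancel ud product≈0))
      where
      product≈0 : (u +r -r v) *r (u +r v) ≈ 0#
      product≈0 = ≈trans (diff-sq u v) (≈trans (+-congʳ e) (-‿inverseʳ (v *r v)))
    ... | inj₂ md with unit-or-M (u +r v)
    ... | inj₁ us = inj₁ (x∙y⁻¹≈ε⇒x≈y u v (unit-cancel us (≈trans (*-comm (u +r v) (u +r -r v)) (≈trans (diff-sq u v) (≈trans (+-congʳ e) (-‿inverseʳ (v *r v)))))))
    ... | inj₂ ms = ⊥-elim (f≢t (≡trans (≡sym (unit⇒¬M (Unit-* two-unit uu))) (M≈ (≈trans (cancel-pair u v) (≈sym (two*x u))) (M+ md ms))))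

    count-roots : ∀ w → Σ' (λ u → χ (Unit? u ×-dec ((u *r u) ≈? w))) ≡ 2 *ℕ χ (Sq? w)
    count-roots w with Sq? w
    ... | yes (v , uv , e) = begin
          Σ' (λ u → χ (Unit? u ×-dec ((u *r u) ≈? w)))
            ≡⟨ sumL-cong elems (λ u → ≡trans (χ-⇔ (to u) (fro u) _ ((u ≈? v) ⊎-dec (u ≈? (-r v))))
                                             (χ-⊎ (u ≈? v) (u ≈? (-r v)) (λ { (a , b) → unit≉neg uv (≈trans (≈sym a) b) }))) ⟩
          Σ' (λ u → χ (u ≈? v) +ℕ χ (u ≈? (-r v))) ≡⟨ sumL-+ elems _ _ ⟩
          Σ' (λ u → χ (u ≈? v)) +ℕ Σ' (λ u → χ (u ≈? (-r v))) ≡⟨ cong₂ _+ℕ_ (δ' v) (δ' (-r v)) ⟩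
          2 ∎
      where
      open Relation.Binary.PropositionalEquality.≡-Reasoning
      to : ∀ u → Unit u × u *r u ≈ w → (u ≈ v) ⊎ (u ≈ -r v)
      to u (uu , p) = sq-inj uu uv (≈trans p e)
      fro : ∀ u → (u ≈ v) ⊎ (u ≈ -r v) → Unit u × u *r u ≈ w
      fro u (inj₁ a) = Unit-resp (≈sym a) uv , ≈trans (*-cong a a) (≈sym e)
      fro u (inj₂ b) = Unit-resp (≈sym b) (Unit-neg uv) , ≈trans (*-cong b b) (≈trans (neg-sq v) (≈sym e))
    ... | no ns = ≡trans (sumL-cong elems (λ u → χ-no (Unit? u ×-dec ((u *r u) ≈? w)) (λ { (uu , p) → ns (u , uu , ≈sym p) }))) (sumL-0 elems)

    sqs : ℕ
    sqs = Σ' (λ x → χ (Sq? x))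

    -- squaring is two-to-one on units: |F^×| = 2 |Q_F|
    units≡2sqs : units ≡ 2 *ℕ sqs
    units≡2sqs = begin
        Σ' U ≡⟨ sumL-cong elems (λ u → ≡sym (≡trans (sumL-*ʳ elems (U u) (λ w → χ ((u *r u) ≈? w))) (≡trans (cong (_*ℕ U u) (δ (u *r u))) (N.*-identityˡ (U u))))) ⟩
        Σ' (λ u → Σ' (λ w → χ ((u *r u) ≈? w) *ℕ U u)) ≡⟨ sumL-swap elems elems _ ⟩
        Σ' (λ w → Σ' (λ u → χ ((u *r u) ≈? w) *ℕ U u)) ≡⟨ sumL-cong elems (λ w → sumL-cong elems (λ u → ≡trans (N.*-comm _ (U u)) (≡sym (χ-× (Unit? u) ((u *r u) ≈? w))))) ⟩
        Σ' (λ w → Σ' (λ u → χ (Unit? u ×-dec ((u *r u) ≈? w)))) ≡⟨ sumL-cong elems count-roots ⟩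
        Σ' (λ w → 2 *ℕ χ (Sq? w)) ≡⟨ sumL-*ˡ elems 2 _ ⟩
        2 *ℕ sqs ∎
      where open Relation.Binary.PropositionalEquality.≡-Reasoning

-- Continuing with q = 2j + 1: the squares of units number |Q| = j m, and
-- inversion is an involution of Q whose fixed points are 1 and, when
-- -1 ∈ Q, also -1.  Comparing parities: -1 ∈ Q iff j is even, i.e.
-- iff q ≡ 1 (mod 4).
module LocalSquares where

  open import Defs
  open Sums
  open LocalOdd
  open Involutions
  open import Data.Nat using (ℕ; suc) renaming (_+_ to _+ℕ_; _*_ to _*ℕ_)
  import Data.Nat.Properties as N
  open import Data.Product using (_×_; _,_; ∃)
  open import Relation.Nullary using (yes; no; ¬_)
  open import Relation.Nullary.Decidable using (_×-dec_; _⊎-dec_)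
  open import Relation.Binary.PropositionalEquality using (_≡_; cong; cong₂) renaming (sym to ≡sym; trans to ≡trans)
  open import Data.Empty using (⊥-elim)
  open import Data.Sum using (_⊎_; inj₁; inj₂)
  open import Data.Nat.Tactic.RingSolver using (solve-∀)

  module Squares (F : FinCommRing) (Mx : Subset F) (loc : IsLocalWithMax F Mx)
                 (q : ℕ) (hq : q *ℕ subsetCard F Mx ≡ card F) (j : ℕ) (qj : q ≡ suc (2 *ℕ j)) where
    open Odd F Mx loc q hq j qj public
    open FinCommRing F using () renaming (reflexive to ≈reflexive)

    fixcount : Σ' (λ x → χ (Sq? x ×-dec (inv x ≈? x))) ≡ suc (χ (Sq? (-r 1#)))
    fixcount = begin
        Σ' (λ x → χ (Sq? x ×-dec (inv x ≈? x)))
          ≡⟨ sumL-cong elems (λ x → ≡trans (χ-⇔ (to x) (fro x) _ ((x ≈? 1#) ⊎-dec ((x ≈? (-r 1#)) ×-dec Sq? (-r 1#))))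
                                           (χ-⊎ (x ≈? 1#) ((x ≈? (-r 1#)) ×-dec Sq? (-r 1#)) (λ { (a , b , _) → unit≉neg Unit-1 (≈trans (≈sym a) b) }))) ⟩
        Σ' (λ x → χ (x ≈? 1#) +ℕ χ ((x ≈? (-r 1#)) ×-dec Sq? (-r 1#))) ≡⟨ sumL-+ elems _ _ ⟩
        Σ' (λ x → χ (x ≈? 1#)) +ℕ Σ' (λ x → χ ((x ≈? (-r 1#)) ×-dec Sq? (-r 1#)))
          ≡⟨ cong₂ _+ℕ_ (δ' 1#) (≡trans (sumL-cong elems (λ x → χ-× (x ≈? (-r 1#)) (Sq? (-r 1#))))
               (≡trans (sumL-*ʳ elems _ (λ x → χ (x ≈? (-r 1#)))) (≡trans (cong (_*ℕ χ (Sq? (-r 1#))) (δ' (-r 1#))) (N.*-identityˡ _)))) ⟩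
        suc (χ (Sq? (-r 1#))) ∎
      where
      open Relation.Binary.PropositionalEquality.≡-Reasoning
      to : ∀ x → Sq x × inv x ≈ x → (x ≈ 1#) ⊎ (x ≈ -r 1# × Sq (-r 1#))
      to x (s , f) with sq-inj (Sq⇒Unit s) Unit-1 (≈trans (≈trans (*-congˡ (≈sym f)) (inv-spec (Sq⇒Unit s))) (≈sym (*-identityˡ 1#)))
      ... | inj₁ a = inj₁ a
      ... | inj₂ b = inj₂ (b , Sq-resp b s)
      fro : ∀ x → (x ≈ 1#) ⊎ (x ≈ -r 1# × Sq (-r 1#)) → Sq x × inv x ≈ x
      fro x (inj₁ a) = (1# , Unit-1 , ≈trans a (≈sym (*-identityˡ 1#))) , ≈trans (≈reflexive (inv-resp a)) (≈trans inv1 (≈sym a))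
      fro x (inj₂ (b , s)) = Sq-resp (≈sym b) s , inv-self (Sq⇒Unit (Sq-resp (≈sym b) s)) (≈trans (*-cong b b) (≈trans (neg-sq 1#) (*-identityˡ 1#)))

    sq-parity : ∃ λ k → sqs ≡ suc (χ (Sq? (-r 1#))) +ℕ 2 *ℕ k
    sq-parity with parity F Sq Sq? Sq-resp inv (λ e → ≈reflexive (inv-resp e)) (λ x s → inv-inv (Sq⇒Unit s)) Sq-inv
    ... | k , sqs≡ = k , ≡trans sqs≡ (cong (_+ℕ 2 *ℕ k) fixcount)

    Nn≡qm : Nn ≡ q *ℕ m
    Nn≡qm = ≡sym (≡trans (cong (q *ℕ_) (≡sym subsetCard≡m)) (≡trans hq card≡N))

    -- |Q| = |F^×| / 2 = (q - 1) m / 2 = j m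
    sqs≡jm : sqs ≡ j *ℕ m
    sqs≡jm = N.*-cancelˡ-≡ sqs (j *ℕ m) 2 (N.+-cancelʳ-≡ m (2 *ℕ sqs) (2 *ℕ (j *ℕ m)) twice)
      where
      open Relation.Binary.PropositionalEquality.≡-Reasoning
      arith : ∀ j m → suc (2 *ℕ j) *ℕ m ≡ 2 *ℕ (j *ℕ m) +ℕ m
      arith = solve-∀
      twice : 2 *ℕ sqs +ℕ m ≡ 2 *ℕ (j *ℕ m) +ℕ m
      twice = begin
          2 *ℕ sqs +ℕ m ≡⟨ cong (_+ℕ m) (≡sym units≡2sqs) ⟩
          units +ℕ m ≡⟨ ≡sym N≡units+m ⟩
          Nn ≡⟨ Nn≡qm ⟩
          q *ℕ m ≡⟨ cong (_*ℕ m) qj ⟩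
          suc (2 *ℕ j) *ℕ m ≡⟨ arith j m ⟩
          2 *ℕ (j *ℕ m) +ℕ m ∎

    -- q ≡ 1 (mod 4): |Q| = 2 t m is even, so -1 ∈ Q
    minus1-sq : ∀ t → j ≡ 2 *ℕ t → Sq (-r 1#)
    minus1-sq t jt with Sq? (-r 1#) | sq-parity
    ... | yes s | _ = s
    ... | no _ | (k , e) = ⊥-elim (N.even≢odd (t *ℕ m) k (≡sym (≡trans (≡sym e) (≡trans sqs≡jm (≡trans (cong (_*ℕ m) jt) (N.*-assoc 2 t m))))))

    -- q ≡ 3 (mod 4): |Q| = (2t + 1) m is odd, so -1 ∉ Q
    minus1-nsq : ∀ t → j ≡ suc (2 *ℕ t) → ¬ Sq (-r 1#)
    minus1-nsq t jt with Sq? (-r 1#) | sq-parity | m-odd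
    ... | no ns | _ | _ = ns
    ... | yes s | (k , e) | (k' , mk) = ⊥-elim (N.even≢odd (suc k) (t +ℕ k' +ℕ 2 *ℕ (t *ℕ k'))
           (≡trans (even k) (≡trans (≡sym e) (≡trans sqs≡jm (≡trans (cong₂ _*ℕ_ jt mk) (odd t k'))))))
      where
      even : ∀ k → 2 *ℕ suc k ≡ suc (1 +ℕ 2 *ℕ k)
      even = solve-∀
      odd : ∀ t k' → suc (2 *ℕ t) *ℕ suc (2 *ℕ k') ≡ suc (2 *ℕ (t +ℕ k' +ℕ 2 *ℕ (t *ℕ k')))
      odd = solve-∀

-- Then -1 ∉ Q, so Q and -Q
-- are disjoint and T = Q ∪ -Q is the whole unit group.  Two vertices at a
-- unit difference c have A U c = q m - 2 m common neighbours (t and t - c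
-- must both be units), whence 6 n3 = Δ U = |F| |F^×| (q - 2) m.
module LocalTriangles3 where

  open import Defs
  open Sums
  open Booleans
  open LocalSquares
  open import Data.Nat using (ℕ; suc; _∸_; _≤_; s≤s; z≤n) renaming (_+_ to _+ℕ_; _*_ to _*ℕ_)
  import Data.Nat.Properties as N
  open import Data.Bool using (true; false)
  open import Data.Product using (_,_)
  open import Relation.Nullary using (yes; no; ¬_)
  open import Relation.Binary.PropositionalEquality using (_≡_; refl; cong; subst) renaming (sym to ≡sym; trans to ≡trans)
  open import Data.Empty using (⊥-elim)
  open import Data.Sum using (inj₁; inj₂)

  module Case3 (F : FinCommRing) (Mx : Subset F) (loc : IsLocalWithMax F Mx)
               (q : ℕ) (hq : q *ℕ subsetCard F Mx ≡ card F) (t : ℕ) (qt : q ≡ suc (2 *ℕ suc (2 *ℕ t))) where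
    open Squares F Mx loc q hq (suc (2 *ℕ t)) qt public

    -1∉Q : ¬ Sq (-r 1#)
    -1∉Q = minus1-nsq t refl

    U≡ : ∀ x → U x ≡ 1 ∸ ind (Mx x)
    U≡ x = ≡trans (≡sym (N.m+n∸n≡m (U x) (ind (Mx x)))) (cong (_∸ ind (Mx x)) (U+M x))

    q≥2 : 2 ≤ q
    q≥2 = subst (2 ≤_) (≡sym qt) (s≤s (s≤s z≤n))

    -- for a unit c, exactly one of: t, t - c both units; t ∈ M; t - c ∈ M
    A-unit : ∀ c → Unit c → A U c ≡ (q ∸ 2) *ℕ m
    A-unit c uc = N.+-cancelʳ-≡ (m +ℕ m) _ _ (begin
        A U c +ℕ (m +ℕ m) ≡⟨ cong (λ k → A U c +ℕ (m +ℕ k)) (≡sym (tr-add (-r c) (λ x → ind (Mx x)) indM-resp)) ⟩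
        A U c +ℕ (m +ℕ Σ' (λ t → ind (Mx (t +r -r c)))) ≡⟨ cong (A U c +ℕ_) (≡sym (sumL-+ elems _ _)) ⟩
        A U c +ℕ Σ' (λ t → ind (Mx t) +ℕ ind (Mx (t +r -r c))) ≡⟨ ≡sym (sumL-+ elems _ _) ⟩
        Σ' (λ t → U t *ℕ U (t +r -r c) +ℕ (ind (Mx t) +ℕ ind (Mx (t +r -r c)))) ≡⟨ sumL-cong elems exactly-one ⟩
        Nn ≡⟨ Nn≡qm ⟩
        q *ℕ m ≡⟨ cong (_*ℕ m) (≡sym (N.m∸n+n≡m q≥2)) ⟩
        (q ∸ 2 +ℕ 2) *ℕ m ≡⟨ N.*-distribʳ-+ m (q ∸ 2) 2 ⟩
        (q ∸ 2) *ℕ m +ℕ 2 *ℕ m ≡⟨ cong ((q ∸ 2) *ℕ m +ℕ_) (cong (m +ℕ_) (N.+-identityʳ m)) ⟩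
        (q ∸ 2) *ℕ m +ℕ (m +ℕ m) ∎)
      where
      open Relation.Binary.PropositionalEquality.≡-Reasoning
      exactly-one : ∀ t → U t *ℕ U (t +r -r c) +ℕ (ind (Mx t) +ℕ ind (Mx (t +r -r c))) ≡ 1
      exactly-one t rewrite U≡ t | U≡ (t +r -r c) with Mx t in e1 | Mx (t +r -r c) in e2
      ... | true | true = ⊥-elim (f≢t (≡trans (≡sym (unit⇒¬M uc)) (M≈ (sub-sub t c) (M+ e1 (Mneg e2)))))
      ... | true | false = refl
      ... | false | true = refl
      ... | false | false = refl

    ΔU : Δ U ≡ Nn *ℕ (units *ℕ ((q ∸ 2) *ℕ m))
    ΔU = Δ-regular U Uresp ((q ∸ 2) *ℕ m) regular
      where
      regular : ∀ c → U c *ℕ A U c ≡ U c *ℕ ((q ∸ 2) *ℕ m)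
      regular c with Unit? c
      ... | yes uc = cong (1 *ℕ_) (A-unit c uc)
      ... | no _ = refl

    -- T = F^×: T ⊆ F^× and |T| = |Q| + |-Q| = 2 |Q| = |F^×|
    T≡units : ∀ x → χ (InT? x) ≡ U x
    T≡units = sum-eq-pw (λ x → χ (InT? x)) U (Resp-χ InT? InT-resp) Uresp
      (λ x → χ-≤ (λ { (inj₁ s) → Sq⇒Unit s ; (inj₂ s) → Unit-resp (-‿involutive x) (Unit-neg (Sq⇒Unit s)) }) (InT? x) (Unit? x))
      (begin
        Σ' (λ x → χ (InT? x)) ≡⟨ sumL-cong elems (λ x → χ-⊎ (Sq? x) (Sq? (-r x)) (λ { (s , s') → -1∉Q (Q∩-Q s s') })) ⟩
        Σ' (λ x → χ (Sq? x) +ℕ χ (Sq? (-r x))) ≡⟨ sumL-+ elems _ _ ⟩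
        sqs +ℕ Σ' (λ x → χ (Sq? (-r x))) ≡⟨ cong (sqs +ℕ_) (tr-neg (λ x → χ (Sq? x)) χSq-resp) ⟩
        sqs +ℕ sqs ≡⟨ cong (sqs +ℕ_) (≡sym (N.+-identityʳ sqs)) ⟩
        2 *ℕ sqs ≡⟨ ≡sym units≡2sqs ⟩
        Σ' U ∎)
      where
      open Relation.Binary.PropositionalEquality.≡-Reasoning
      -- x, -x ∈ Q forces -1 = (-x) x⁻¹ ∈ Q
      Q∩-Q : ∀ {x} → Sq x → Sq (-r x) → Sq (-r 1#)
      Q∩-Q {x} s s' = Sq-resp (≈trans (≈sym (-‿distribˡ-* x (inv x))) (-‿cong (inv-spec (Sq⇒Unit s)))) (Sq-mul s' (Sq-inv x s))

    triangles3 : Δ (λ x → χ (InT? x)) ≡ Nn *ℕ (units *ℕ ((q ∸ 2) *ℕ m))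
    triangles3 = ≡trans (Δ-cong T≡units) ΔU

-- Then
-- -1 ∈ Q, so T = Q.  The key input is that 1 + M ⊆ Q (squaring is a
-- bijection of 1 + M), so Q + M = Q and the number A S c of common
-- neighbours depends only on the type of c; a double count then gives
-- A S 1 = (t - 1) m for q = 4t + 1, and 8 Δ(Q) = m |F| |F^×| (q - 5).
module LocalTriangles1 where

  open import Defs
  open Sums
  open Booleans
  open LocalSquares
  open import Data.Nat using (ℕ; suc; _∸_; _≤_; >-nonZero) renaming (_+_ to _+ℕ_; _*_ to _*ℕ_)
  import Data.Nat.Properties as N
  open import Data.Bool using (true; false)
  import Data.Bool as B
  open import Data.Product using (_×_; _,_; proj₁; proj₂; ∃)
  open import Relation.Nullary using (Dec; yes; no; ¬_)
  open import Relation.Nullary.Decidable using (_×-dec_; ¬?)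
  open import Relation.Binary.PropositionalEquality using (_≡_; refl; cong; cong₂) renaming (sym to ≡sym; trans to ≡trans)
  open import Data.Empty using (⊥-elim)
  open import Data.Sum using (inj₁; inj₂)
  open import Data.Nat.Tactic.RingSolver using (solve-∀)

  module OnePlusM (F : FinCommRing) (Mx : Subset F) (loc : IsLocalWithMax F Mx)
                  (q : ℕ) (hq : q *ℕ subsetCard F Mx ≡ card F) (j : ℕ) (qj : q ≡ suc (2 *ℕ j)) where
    open Squares F Mx loc q hq j qj public

    P : Carrier → Set
    P u = Mx (u +r -r 1#) ≡ true

    P? : ∀ u → Dec (P u)
    P? u = Mx (u +r -r 1#) B.≟ true

    P-resp : RespP P
    P-resp e p = M≈ (+-congʳ e) p

    P⇒unit : ∀ {u} → P u → Unit u
    P⇒unit {u} p with unit-or-M u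
    ... | inj₁ uu = uu
    ... | inj₂ mu = ⊥-elim (f≢t (≡trans (≡sym M1) (M≈ (sub-sub u 1#) (M+ mu (Mneg p)))))

    |1+M|≡m : Σ' (λ u → χ (P? u)) ≡ m
    |1+M|≡m = ≡trans (sumL-cong elems (λ u → χ-ind (Mx (u +r -r 1#)))) (tr-add (-r 1#) (λ x → ind (Mx x)) indM-resp)

    -- squaring maps 1 + M into itself: u² - 1 = (u + 1)(u - 1)
    P-sq : ∀ {u} → P u → P (u *r u)
    P-sq {u} p = M≈ factor (M* (u +r 1#) p)
      where
      factor : (u +r 1#) *r (u +r -r 1#) ≈ u *r u +r -r 1#
      factor = ≈trans (*-comm _ _) (≈trans (diff-sq u 1#) (+-congˡ (-‿cong (*-identityˡ 1#))))

    -- squaring is injective on 1 + M: u = -u' would give -2 = (u - 1) + (u' - 1) ∈ M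
    P-sq-inj : ∀ {u u'} → P u → P u' → u *r u ≈ u' *r u' → u ≈ u'
    P-sq-inj {u} {u'} p p' e with sq-inj (P⇒unit p) (P⇒unit p') e
    ... | inj₁ u≈u' = u≈u'
    ... | inj₂ u≈-u' = ⊥-elim (f≢t (≡trans (≡sym two∉M) (M≈ (-‿involutive two) (Mneg (M≈ sum≈-2 (M+ p p'))))))
      where
      open import Relation.Binary.Reasoning.Setoid setoid
      sum≈-2 : (u +r -r 1#) +r (u' +r -r 1#) ≈ -r two
      sum≈-2 = begin
        (u +r -r 1#) +r (u' +r -r 1#) ≈⟨ +-interchange u (-r 1#) u' (-r 1#) ⟩
        (u +r u') +r (-r 1# +r -r 1#) ≈⟨ +-congʳ (≈trans (+-congʳ u≈-u') (-‿inverseˡ u')) ⟩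
        0# +r (-r 1# +r -r 1#) ≈⟨ +-identityˡ _ ⟩
        -r 1# +r -r 1# ≈⟨ ≈sym (-‿anti-homo-+ 1# 1#) ⟩
        -r two ∎

    Root : Carrier → Carrier → Set
    Root w u = P u × u *r u ≈ w

    Root? : ∀ w u → Dec (Root w u)
    Root? w u = P? u ×-dec ((u *r u) ≈? w)

    Root-resp : ∀ w → RespP (Root w)
    Root-resp w e (p , f) = P-resp e p , ≈trans (*-cong (≈sym e) (≈sym e)) f

    HasRoot? : ∀ w → Dec (∃ (Root w))
    HasRoot? w = ∃? (Root w) (Root-resp w) (Root? w)

    -- the image of squaring on 1 + M has |1 + M| = m elements (injectivity)
    |image|≡m : Σ' (λ w → χ (HasRoot? w)) ≡ m
    |image|≡m = begin
        Σ' (λ w → χ (HasRoot? w)) ≡⟨ sumL-cong elems (λ w → ≡sym (sum-unique (Root w) (Root? w) (Root-resp w) (λ (p , f) (p' , f') → P-sq-inj p p' (≈trans f (≈sym f'))))) ⟩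
        Σ' (λ w → Σ' (λ u → χ (Root? w u))) ≡⟨ sumL-swap elems elems _ ⟩
        Σ' (λ u → Σ' (λ w → χ (Root? w u))) ≡⟨ sumL-cong elems (λ u → sumL-cong elems (λ w → χ-× (P? u) ((u *r u) ≈? w))) ⟩
        Σ' (λ u → Σ' (λ w → χ (P? u) *ℕ χ ((u *r u) ≈? w))) ≡⟨ sumL-cong elems (λ u → ≡trans (sumL-*ˡ elems (χ (P? u)) _) (≡trans (cong (χ (P? u) *ℕ_) (δ (u *r u))) (N.*-identityʳ _))) ⟩
        Σ' (λ u → χ (P? u)) ≡⟨ |1+M|≡m ⟩
        m ∎
      where open Relation.Binary.PropositionalEquality.≡-Reasoning

    onto : ∀ w → χ (HasRoot? w) ≡ χ (P? w)
    onto = sum-eq-pw (λ w → χ (HasRoot? w)) (λ w → χ (P? w))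
      (λ {w} {w'} e → χ-⇔ (λ { (u , p , f) → u , p , ≈trans f e }) (λ { (u , p , f) → u , p , ≈trans f (≈sym e) }) (HasRoot? w) (HasRoot? w'))
      (Resp-χ P? P-resp)
      (λ w → χ-≤ (λ { (u , p , f) → P-resp f (P-sq p) }) (HasRoot? w) (P? w))
      (≡trans |image|≡m (≡sym |1+M|≡m))

    onePlusM : ∀ {w} → P w → Sq w
    onePlusM {w} pw with χ-1 (HasRoot? w) (≡trans (onto w) (χ-yes (P? w) pw))
    ... | u , p , f = u , P⇒unit p , ≈sym f

    -- Q + M = Q: s + a = s (1 + s⁻¹ a) with 1 + s⁻¹ a ∈ 1 + M ⊆ Q
    Sq+M : ∀ {s a} → Sq s → Mx a ≡ true → Sq (s +r a)
    Sq+M {s} {a} ss ma = Sq-resp factor (Sq-mul ss (onePlusM in-1+M))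
      where
      in-1+M : P (1# +r inv s *r a)
      in-1+M = M≈ (≈sym (≈trans (+-congʳ (+-comm 1# (inv s *r a))) (add-sub (inv s *r a) 1#))) (M* (inv s) ma)
      factor : s *r (1# +r inv s *r a) ≈ s +r a
      factor = ≈trans (distribˡ s 1# (inv s *r a)) (+-cong (*-identityʳ s)
        (≈trans (≈sym (*-assoc s (inv s) a)) (≈trans (*-congʳ (inv-spec (Sq⇒Unit ss))) (*-identityˡ a))))

  module Case1 (F : FinCommRing) (Mx : Subset F) (loc : IsLocalWithMax F Mx)
               (q : ℕ) (hq : q *ℕ subsetCard F Mx ≡ card F) (t : ℕ) (qt : q ≡ suc (2 *ℕ (2 *ℕ t))) where
    open OnePlusM F Mx loc q hq (2 *ℕ t) qt public

    -1∈Q : Sq (-r 1#)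
    -1∈Q = minus1-sq t refl

    S : Carrier → ℕ
    S x = χ (Sq? x)

    Mi : Carrier → ℕ
    Mi x = ind (Mx x)

    Nq : Carrier → Set
    Nq x = Unit x × ¬ Sq x

    Nq? : ∀ x → Dec (Nq x)
    Nq? x = Unit? x ×-dec ¬? (Sq? x)

    NqI : Carrier → ℕ
    NqI x = χ (Nq? x)

    NqI-resp : Resp NqI
    NqI-resp = Resp-χ Nq? (λ e (u , ns) → Unit-resp e u , λ s → ns (Sq-resp (≈sym e) s))

    partition : ∀ x → S x +ℕ NqI x +ℕ Mi x ≡ 1
    partition x with Sq? x | Unit? x
    ... | yes s | yes u rewrite unit⇒¬M u = refl
    ... | yes s | no nu = ⊥-elim (nu (Sq⇒Unit s))
    ... | no ns | yes u rewrite unit⇒¬M u = refl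
    ... | no ns | no nu rewrite ¬unit⇒M nu = refl

    nqs : Σ' NqI ≡ sqs
    nqs = N.+-cancelˡ-≡ sqs _ _ (N.+-cancelʳ-≡ m _ _ (begin
        sqs +ℕ Σ' NqI +ℕ m ≡⟨ cong (_+ℕ m) (≡sym (sumL-+ elems S NqI)) ⟩
        Σ' (λ x → S x +ℕ NqI x) +ℕ m ≡⟨ ≡sym (sumL-+ elems _ Mi) ⟩
        Σ' (λ x → S x +ℕ NqI x +ℕ Mi x) ≡⟨ sumL-cong elems partition ⟩
        Nn ≡⟨ N≡units+m ⟩
        units +ℕ m ≡⟨ cong (_+ℕ m) (≡trans units≡2sqs (cong (sqs +ℕ_) (N.+-identityʳ sqs))) ⟩
        sqs +ℕ sqs +ℕ m ∎))
      where open Relation.Binary.PropositionalEquality.≡-Reasoning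

    -- the product of two nonsquare units is a square (multiplication by a
    -- nonsquare maps the nonsquares injectively into Q, which has the same size)
    Nq-mul : ∀ {a w} → Nq a → Nq w → Sq (a *r w)
    Nq-mul {a} {w} na nw = χ-1 (Sq? (a *r w)) (≡trans (pw w) (χ-yes (Nq? w) nw))
      where
      g : Carrier → ℕ
      g w = χ (Sq? (a *r w))
      pw : ∀ w → g w ≡ NqI w
      pw = sum-eq-pw g NqI (Resp-∘ (a *r_) χSq-resp *-congˡ) NqI-resp
        (λ w → χ-≤ (λ s → Unit-factorʳ (Sq⇒Unit s) , λ sw → proj₂ na (Sq-div sw (Sq-resp (*-comm a w) s))) (Sq? (a *r w)) (Nq? w))
        (≡trans (tr-mul (proj₁ na) S χSq-resp) (≡sym nqs))

    -- common neighbours of adjacent vertices (difference 1) and of vertices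
    -- at a nonsquare difference
    α : ℕ
    α = A S 1#

    B : ℕ
    B = Σ' (λ t → NqI t *ℕ NqI (t +r -r 1#))

    scale-id : ∀ c t → c *r t +r -r c ≈ c *r (t +r -r 1#)
    scale-id c t = ≈sym (≈trans (distribˡ c t (-r 1#)) (+-congˡ (≈trans (≈sym (-‿distribʳ-* c 1#)) (-‿cong (*-identityʳ c)))))

    A-scaled : ∀ {c} → Unit c → A S c ≡ Σ' (λ t → S (c *r t) *ℕ S (c *r (t +r -r 1#)))
    A-scaled {c} uc = ≡trans (≡sym (tr-mul uc (λ t → S t *ℕ S (t +r -r c)) (Resp-* χSq-resp (Resp-∘ (λ t → t +r -r c) χSq-resp +-congʳ))))
      (sumL-cong elems (λ t → cong (S (c *r t) *ℕ_) (χSq-resp (scale-id c t))))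

    A-sq : ∀ {c} → Sq c → A S c ≡ α
    A-sq {c} sc = ≡trans (A-scaled (Sq⇒Unit sc)) (sumL-cong elems (λ t → cong₂ _*ℕ_ (e t) (e (t +r -r 1#))))
      where
      e : ∀ w → S (c *r w) ≡ S w
      e w = χ-⇔ (Sq-div sc) (Sq-mul sc) (Sq? (c *r w)) (Sq? w)

    A-nq : ∀ {c} → Nq c → A S c ≡ B
    A-nq {c} nc = ≡trans (A-scaled (proj₁ nc)) (sumL-cong elems (λ t → cong₂ _*ℕ_ (e t) (e (t +r -r 1#))))
      where
      e : ∀ w → S (c *r w) ≡ NqI w
      e w = χ-⇔ (λ s → Unit-factorʳ (Sq⇒Unit s) , λ sw → proj₂ nc (Sq-div sw (Sq-resp (*-comm c w) s))) (Nq-mul nc) (Sq? (c *r w)) (Nq? w)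

    A-M : ∀ {c} → Mx c ≡ true → A S c ≡ sqs
    A-M {c} mc = sumL-cong elems (λ t → ≡trans (cong (S t *ℕ_) (χ-⇔ (λ s → Sq-resp (sub-add t c) (Sq+M s mc)) (λ s → Sq+M s (Mneg mc)) (Sq? (t +r -r c)) (Sq? t))) (χ-idem (Sq? t)))

    sqs>0 : 1 ≤ sqs
    sqs>0 = N.≤-trans (N.≤-reflexive (≡sym (χ-yes (Sq? 1#) (1# , Unit-1 , ≈sym (*-identityˡ 1#))))) (le-sum S χSq-resp 1#)

    -- two ways of summing A S over all c
    total : Σ' (λ c → A S c) ≡ sqs *ℕ sqs
    total = begin
        Σ' (λ c → Σ' (λ t → S t *ℕ S (t +r -r c))) ≡⟨ sumL-swap elems elems _ ⟩
        Σ' (λ t → Σ' (λ c → S t *ℕ S (t +r -r c))) ≡⟨ sumL-cong elems (λ t → ≡trans (sumL-*ˡ elems (S t) _) (cong (S t *ℕ_) (tr-sub t S χSq-resp))) ⟩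
        Σ' (λ t → S t *ℕ sqs) ≡⟨ sumL-*ʳ elems sqs S ⟩
        sqs *ℕ sqs ∎
      where open Relation.Binary.PropositionalEquality.≡-Reasoning

    split : Σ' (λ c → A S c) ≡ sqs *ℕ α +ℕ sqs *ℕ B +ℕ m *ℕ sqs
    split = begin
        Σ' (λ c → A S c) ≡⟨ sumL-cong elems (λ c → ≡sym (≡trans (cong (_*ℕ A S c) (partition c)) (N.*-identityˡ _))) ⟩
        Σ' (λ c → (S c +ℕ NqI c +ℕ Mi c) *ℕ A S c) ≡⟨ sumL-cong elems (λ c → ≡trans (N.*-distribʳ-+ (A S c) (S c +ℕ NqI c) (Mi c)) (cong (_+ℕ Mi c *ℕ A S c) (N.*-distribʳ-+ (A S c) (S c) (NqI c)))) ⟩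
        Σ' (λ c → S c *ℕ A S c +ℕ NqI c *ℕ A S c +ℕ Mi c *ℕ A S c) ≡⟨ sumL-cong elems (λ c → cong₂ _+ℕ_ (cong₂ _+ℕ_ (p1 c) (p2 c)) (p3 c)) ⟩
        Σ' (λ c → S c *ℕ α +ℕ NqI c *ℕ B +ℕ Mi c *ℕ sqs) ≡⟨ ≡trans (sumL-+ elems _ _) (cong (_+ℕ Σ' (λ c → Mi c *ℕ sqs)) (sumL-+ elems _ _)) ⟩
        Σ' (λ c → S c *ℕ α) +ℕ Σ' (λ c → NqI c *ℕ B) +ℕ Σ' (λ c → Mi c *ℕ sqs)
          ≡⟨ cong₂ _+ℕ_ (cong₂ _+ℕ_ (sumL-*ʳ elems α S)
                                    (≡trans (sumL-*ʳ elems B NqI) (cong (_*ℕ B) nqs)))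
                        (sumL-*ʳ elems sqs Mi) ⟩
        sqs *ℕ α +ℕ sqs *ℕ B +ℕ m *ℕ sqs ∎
      where
      open Relation.Binary.PropositionalEquality.≡-Reasoning
      p1 : ∀ c → S c *ℕ A S c ≡ S c *ℕ α
      p1 c with Sq? c
      ... | yes s = cong (1 *ℕ_) (A-sq s)
      ... | no _ = refl
      p2 : ∀ c → NqI c *ℕ A S c ≡ NqI c *ℕ B
      p2 c with Nq? c
      ... | yes n = cong (1 *ℕ_) (A-nq n)
      ... | no _ = refl
      p3 : ∀ c → Mi c *ℕ A S c ≡ Mi c *ℕ sqs
      p3 c with Mx c in e
      ... | true = cong (1 *ℕ_) (A-M e)
      ... | false = refl

    aNQ : ℕ
    aNQ = Σ' (λ t → NqI t *ℕ S (t +r -r 1#))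

    -- classifying t by its type, for t - 1 ∈ Q
    from-squares : α +ℕ aNQ +ℕ m ≡ sqs
    from-squares = begin
        α +ℕ aNQ +ℕ m ≡⟨ cong (α +ℕ aNQ +ℕ_) (≡sym (sumL-cong elems pM)) ⟩
        α +ℕ aNQ +ℕ Σ' (λ t → Mi t *ℕ S (t +r -r 1#)) ≡⟨ cong (_+ℕ Σ' (λ t → Mi t *ℕ S (t +r -r 1#))) (≡sym (sumL-+ elems _ _)) ⟩
        Σ' (λ t → S t *ℕ S (t +r -r 1#) +ℕ NqI t *ℕ S (t +r -r 1#)) +ℕ Σ' (λ t → Mi t *ℕ S (t +r -r 1#)) ≡⟨ ≡sym (sumL-+ elems _ _) ⟩
        Σ' (λ t → S t *ℕ S (t +r -r 1#) +ℕ NqI t *ℕ S (t +r -r 1#) +ℕ Mi t *ℕ S (t +r -r 1#))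
          ≡⟨ sumL-cong elems (λ t → ≡trans (≡sym (cong (_+ℕ Mi t *ℕ S (t +r -r 1#)) (N.*-distribʳ-+ (S (t +r -r 1#)) (S t) (NqI t)))) (≡sym (N.*-distribʳ-+ (S (t +r -r 1#)) (S t +ℕ NqI t) (Mi t)))) ⟩
        Σ' (λ t → (S t +ℕ NqI t +ℕ Mi t) *ℕ S (t +r -r 1#)) ≡⟨ sumL-cong elems (λ t → ≡trans (cong (_*ℕ S (t +r -r 1#)) (partition t)) (N.*-identityˡ _)) ⟩
        Σ' (λ t → S (t +r -r 1#)) ≡⟨ tr-add (-r 1#) S χSq-resp ⟩
        sqs ∎
      where
      open Relation.Binary.PropositionalEquality.≡-Reasoning
      pM : ∀ t → Mi t *ℕ S (t +r -r 1#) ≡ Mi t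
      pM t with Mx t in e
      ... | true = ≡trans (N.*-identityˡ _) (χ-yes (Sq? (t +r -r 1#)) (Sq-resp (+-comm (-r 1#) t) (Sq+M -1∈Q e)))
      ... | false = refl

    -- classifying t - 1 by its type, for t a nonsquare unit (t - 1 ∉ M, as 1 + M ⊆ Q)
    from-nonsquares : aNQ +ℕ B ≡ sqs
    from-nonsquares = begin
        aNQ +ℕ B ≡⟨ ≡sym (N.+-identityʳ _) ⟩
        aNQ +ℕ B +ℕ 0 ≡⟨ cong (aNQ +ℕ B +ℕ_) (≡sym (≡trans (sumL-cong elems pNM) (sumL-0 elems))) ⟩
        aNQ +ℕ B +ℕ Σ' (λ t → NqI t *ℕ Mi (t +r -r 1#)) ≡⟨ cong (_+ℕ Σ' (λ t → NqI t *ℕ Mi (t +r -r 1#))) (≡sym (sumL-+ elems _ _)) ⟩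
        Σ' (λ t → NqI t *ℕ S (t +r -r 1#) +ℕ NqI t *ℕ NqI (t +r -r 1#)) +ℕ Σ' (λ t → NqI t *ℕ Mi (t +r -r 1#)) ≡⟨ ≡sym (sumL-+ elems _ _) ⟩
        Σ' (λ t → NqI t *ℕ S (t +r -r 1#) +ℕ NqI t *ℕ NqI (t +r -r 1#) +ℕ NqI t *ℕ Mi (t +r -r 1#))
          ≡⟨ sumL-cong elems (λ t → ≡trans (≡sym (cong (_+ℕ NqI t *ℕ Mi (t +r -r 1#)) (N.*-distribˡ-+ (NqI t) (S (t +r -r 1#)) (NqI (t +r -r 1#))))) (≡sym (N.*-distribˡ-+ (NqI t) (S (t +r -r 1#) +ℕ NqI (t +r -r 1#)) (Mi (t +r -r 1#))))) ⟩
        Σ' (λ t → NqI t *ℕ (S (t +r -r 1#) +ℕ NqI (t +r -r 1#) +ℕ Mi (t +r -r 1#))) ≡⟨ sumL-cong elems (λ t → ≡trans (cong (NqI t *ℕ_) (partition (t +r -r 1#))) (N.*-identityʳ _)) ⟩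
        Σ' NqI ≡⟨ nqs ⟩
        sqs ∎
      where
      open Relation.Binary.PropositionalEquality.≡-Reasoning
      pNM : ∀ t → NqI t *ℕ Mi (t +r -r 1#) ≡ 0
      pNM t with Mx (t +r -r 1#) in e
      ... | true = ≡trans (N.*-identityʳ _) (χ-no (Nq? t) (λ { (_ , ns) → ns (onePlusM e) }))
      ... | false = N.*-zeroʳ (NqI t)

    B≡ : B ≡ α +ℕ m
    B≡ = N.+-cancelˡ-≡ aNQ _ _ (≡trans from-nonsquares (≡trans (≡sym from-squares) (ar α aNQ m)))
      where
      ar : ∀ a b c → a +ℕ b +ℕ c ≡ b +ℕ (a +ℕ c)
      ar = solve-∀

    sqs≡ : sqs ≡ α +ℕ B +ℕ m
    sqs≡ = N.*-cancelˡ-≡ sqs (α +ℕ B +ℕ m) sqs {{>-nonZero sqs>0}} (≡trans (≡sym total) (≡trans split (ar sqs α B m)))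
      where
      ar : ∀ s a b m → s *ℕ a +ℕ s *ℕ b +ℕ m *ℕ s ≡ s *ℕ (a +ℕ b +ℕ m)
      ar = solve-∀

    α+m : α +ℕ m ≡ t *ℕ m
    α+m = N.*-cancelˡ-≡ (α +ℕ m) (t *ℕ m) 2 (≡trans (ar α m) (≡trans (≡sym (≡trans sqs≡ (cong (λ b → α +ℕ b +ℕ m) B≡))) (≡trans sqs≡jm (N.*-assoc 2 t m))))
      where
      ar : ∀ a m → 2 *ℕ (a +ℕ m) ≡ a +ℕ (a +ℕ m) +ℕ m
      ar = solve-∀

    α≡ : α ≡ (t ∸ 1) *ℕ m
    α≡ = ≡trans (≡sym (N.m+n∸n≡m α m)) (≡trans (cong (_∸ m) α+m) (≡trans (cong (t *ℕ m ∸_) (≡sym (N.*-identityˡ m))) (≡sym (N.*-distribʳ-∸ m t 1))))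

    ΔS : Δ S ≡ Nn *ℕ (sqs *ℕ α)
    ΔS = Δ-regular S χSq-resp α p1
      where
      p1 : ∀ c → S c *ℕ A S c ≡ S c *ℕ α
      p1 c with Sq? c
      ... | yes s = cong (1 *ℕ_) (A-sq s)
      ... | no _ = refl

    q∸5 : q ∸ 5 ≡ 4 *ℕ (t ∸ 1)
    q∸5 = ≡trans (cong (_∸ 5) qt) (≡trans (cong (_∸ 4) (≡sym (N.*-assoc 2 2 t))) (≡sym (N.*-distribˡ-∸ 4 t 1)))

    -- 8 Δ(Q) = 8 |F| |Q| (t - 1) m = m |F| |F^×| (q - 5)
    triangles1 : 8 *ℕ Δ S ≡ m *ℕ Nn *ℕ units *ℕ (q ∸ 5)
    triangles1 = begin
        8 *ℕ Δ S ≡⟨ cong (8 *ℕ_) ΔS ⟩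
        8 *ℕ (Nn *ℕ (sqs *ℕ α)) ≡⟨ cong (λ a → 8 *ℕ (Nn *ℕ (sqs *ℕ a))) α≡ ⟩
        8 *ℕ (Nn *ℕ (sqs *ℕ ((t ∸ 1) *ℕ m))) ≡⟨ arith Nn sqs (t ∸ 1) m ⟩
        m *ℕ Nn *ℕ (2 *ℕ sqs) *ℕ (4 *ℕ (t ∸ 1)) ≡⟨ cong₂ (λ a b → m *ℕ Nn *ℕ a *ℕ b) (≡sym units≡2sqs) (≡sym q∸5) ⟩
        m *ℕ Nn *ℕ units *ℕ (q ∸ 5) ∎
      where
      open Relation.Binary.PropositionalEquality.≡-Reasoning
      arith : ∀ n s d m → 8 *ℕ (n *ℕ (s *ℕ (d *ℕ m))) ≡ m *ℕ n *ℕ (2 *ℕ s) *ℕ (4 *ℕ d)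
      arith = solve-∀

open import Defs
open import Data.Nat using (ℕ; zero; suc; _+_; _*_; _∸_; _^_; _%_; _≤_; _/_)
open import Data.Fin using (Fin) renaming (_≤_ to _≤ᶠ_)
open import Data.List using (map; allFin)
open import Data.Nat.ListAction using (product)
open import Data.Vec using (Vec; lookup; _∷_) renaming (map to vmap)
open import Data.Product using (_×_)
open import Relation.Binary.PropositionalEquality using (_≡_)
open import Relation.Nullary using (¬_)

import Data.Nat.DivMod as DivMod
open import Data.Nat.Properties using (*-identityʳ)
import Data.Fin as Fin
import Data.List.Properties as ListProperties
import Data.Vec as Vec
open import Data.Product using (_,_; proj₁; proj₂)
open import Relation.Binary.PropositionalEquality using (refl; cong; cong₂; subst) renaming (sym to ≡sym; trans to ≡trans)
open import Data.Nat.Tactic.RingSolver using (solve-∀)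
import Algebra.Construct.DirectProduct as DP
open Sums using (χ)
open CayleyGraph using (module Cayley)
open Isomorphism using (module Iso)
open Products using (prodF; module ProdFacts)
open LocalTriangles3 using (module Case3)
open LocalTriangles1 using (module Case1)

prodF* : ∀ {k} → Vec FinCommRing (suc k) → FinCommRing
prodF* (R ∷ Vec.[]) = R
prodF* (R ∷ S ∷ Rs) = prodF R (prodF* (S ∷ Rs))

prodF*-cring : ∀ {k} (Rs : Vec FinCommRing (suc k)) → FinCommRing.cring (prodF* Rs) ≡ prodRing (vmap FinCommRing.cring Rs)
prodF*-cring (R ∷ Vec.[]) = refl
prodF*-cring (R ∷ S ∷ Rs) = cong (DP.commutativeRing (FinCommRing.cring R)) (prodF*-cring (S ∷ Rs))

prodF*-cons : ∀ {k} (R : FinCommRing) (Rs : Vec FinCommRing (suc k)) → prodF* (R ∷ Rs) ≡ prodF R (prodF* Rs)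
prodF*-cons R (S ∷ Rs) = refl

ΔQ : ∀ {k} → Vec FinCommRing (suc k) → ℕ
ΔQ Rs = Cayley.Δ (prodF* Rs) (λ x → χ (Cayley.Sq? (prodF* Rs) x))

q≡1mod4 : ∀ q → q % 4 ≡ 1 → q ≡ suc (2 * (2 * (q / 4)))
q≡1mod4 q h = ≡trans (DivMod.m≡m%n+[m/n]*n q 4) (≡trans (cong (_+ (q / 4) * 4) h) (arith (q / 4)))
  where
  arith : ∀ t → 1 + t * 4 ≡ suc (2 * (2 * t))
  arith = solve-∀

q≡3mod4 : ∀ q → q % 4 ≡ 3 → q ≡ suc (2 * suc (2 * (q / 4)))
q≡3mod4 q h = ≡trans (DivMod.m≡m%n+[m/n]*n q 4) (≡trans (cong (_+ (q / 4) * 4) h) (arith (q / 4)))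
  where
  arith : ∀ t → 3 + t * 4 ≡ suc (2 * suc (2 * t))
  arith = solve-∀

weight : (R : FinCommRing) (M : Subset R) (q d : ℕ) → ℕ
weight R M q d = subsetCard R M * card R * unitCard R * (q ∸ d)

local-3mod4 : (R : FinCommRing) (M : Subset R) → IsLocalWithMax R M → (q : ℕ) → q * subsetCard R M ≡ card R → q % 4 ≡ 3 →
  ¬ (FinCommRing._≈_ R (FinCommRing.1# R) (FinCommRing.0# R)) × (6 * n3 R ≡ weight R M q 2)
local-3mod4 R M loc q hq hm = C.1≉0 , (begin
    6 * n3 R ≡⟨ C.n3≡Δ C.1≉0 ⟩
    C.Δ C.τ ≡⟨ C.Δ-cong C.τ≡ ⟩
    C.Δ (λ x → χ (C.InT? x)) ≡⟨ C.triangles3 ⟩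
    C.Nn * (C.units * ((q ∸ 2) * C.m)) ≡⟨ arith C.Nn C.units (q ∸ 2) C.m ⟩
    C.m * C.Nn * C.units * (q ∸ 2) ≡⟨ cong₂ (λ a b → a * b * (q ∸ 2)) (cong₂ _*_ (≡sym C.subsetCard≡m) (≡sym C.card≡N)) (≡sym C.unitCard≡) ⟩
    weight R M q 2 ∎)
  where
  open Relation.Binary.PropositionalEquality.≡-Reasoning
  module C = Case3 R M loc q hq (q / 4) (q≡3mod4 q hm)
  arith : ∀ n u d m → n * (u * (d * m)) ≡ m * n * u * d
  arith = solve-∀

local-1mod4 : (R : FinCommRing) (M : Subset R) → IsLocalWithMax R M → (q : ℕ) → q * subsetCard R M ≡ card R → q % 4 ≡ 1 →
  Cayley.Sq R (FinCommRing.-_ R (FinCommRing.1# R)) × (8 * Cayley.Δ R (λ x → χ (Cayley.Sq? R x)) ≡ weight R M q 5)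
local-1mod4 R M loc q hq hm = C.-1∈Q , ≡trans C.triangles1
    (cong₂ (λ a b → a * b * (q ∸ 5)) (cong₂ _*_ (≡sym C.subsetCard≡m) (≡sym C.card≡N)) (≡sym C.unitCard≡))
  where
  module C = Case1 R M loc q hq (q / 4) (q≡1mod4 q hm)

-- Part (b) for the explicit product: -1 is a square and 8^s Δ(Q) is the
-- product of the local factors (Δ is multiplicative, -1 ∈ Q coordinatewise)
product-1mod4 : ∀ k (Rs : Vec FinCommRing (suc k)) (Ms : (i : Fin (suc k)) → Subset (lookup Rs i)) →
    (∀ i → IsLocalWithMax (lookup Rs i) (Ms i)) →
    (qs : Fin (suc k) → ℕ) →
    (∀ i → qs i * subsetCard (lookup Rs i) (Ms i) ≡ card (lookup Rs i)) →
    (∀ i → qs i % 4 ≡ 1) →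
    Cayley.Sq (prodF* Rs) (FinCommRing.-_ (prodF* Rs) (FinCommRing.1# (prodF* Rs))) ×
    (8 ^ suc k * ΔQ Rs ≡
      product (map (λ i → weight (lookup Rs i) (Ms i) (qs i) 5) (allFin (suc k))))
product-1mod4 zero (R ∷ Vec.[]) Ms locs qs hqs hms =
  proj₁ single , ≡trans (proj₂ single) (≡sym (*-identityʳ _))
  where
  single : Cayley.Sq R (FinCommRing.-_ R (FinCommRing.1# R)) × (8 * Cayley.Δ R (λ x → χ (Cayley.Sq? R x)) ≡ weight R (Ms Fin.zero) (qs Fin.zero) 5)
  single = local-1mod4 R (Ms Fin.zero) (locs Fin.zero) (qs Fin.zero) (hqs Fin.zero) (hms Fin.zero)
product-1mod4 (suc k) (R ∷ S ∷ Rs) Ms locs qs hqs hms =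
  ProdFacts.⇒Sq R P (proj₁ head) (proj₁ tail) , (begin
    8 ^ suc (suc k) * Cayley.Δ (prodF R P) (λ x → χ (Cayley.Sq? (prodF R P) x))
      ≡⟨ cong (8 ^ suc (suc k) *_) (≡trans (Cayley.Δ-cong (prodF R P) (λ p → ProdFacts.χSq R P (proj₁ p) (proj₂ p))) (ProdFacts.Δ-prod R P QR QP)) ⟩
    8 ^ suc (suc k) * (Cayley.Δ R QR * Cayley.Δ P QP)
      ≡⟨ arith (8 ^ suc k) (Cayley.Δ R QR) (Cayley.Δ P QP) ⟩
    (8 * Cayley.Δ R QR) * (8 ^ suc k * Cayley.Δ P QP)
      ≡⟨ cong₂ _*_ (proj₂ head) (proj₂ tail) ⟩
    w Fin.zero * product (map (λ i → w (Fin.suc i)) (allFin (suc k)))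
      ≡⟨ cong (λ l → w Fin.zero * product l) (≡trans (ListProperties.map-tabulate (λ i → i) (λ i → w (Fin.suc i))) (≡sym (ListProperties.map-tabulate Fin.suc w))) ⟩
    product (map w (allFin (suc (suc k)))) ∎)
  where
  open Relation.Binary.PropositionalEquality.≡-Reasoning
  P : FinCommRing
  P = prodF* (S ∷ Rs)
  QR : FinCommRing.Carrier R → ℕ
  QR x = χ (Cayley.Sq? R x)
  QP : FinCommRing.Carrier P → ℕ
  QP x = χ (Cayley.Sq? P x)
  w : Fin (suc (suc k)) → ℕ
  w i = weight (lookup (R ∷ S ∷ Rs) i) (Ms i) (qs i) 5
  head : Cayley.Sq R (FinCommRing.-_ R (FinCommRing.1# R)) × (8 * Cayley.Δ R QR ≡ w Fin.zero)
  head = local-1mod4 R (Ms Fin.zero) (locs Fin.zero) (qs Fin.zero) (hqs Fin.zero) (hms Fin.zero)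
  tail : Cayley.Sq P (FinCommRing.-_ P (FinCommRing.1# P)) ×
    (8 ^ suc k * Cayley.Δ P QP ≡ product (map (λ i → w (Fin.suc i)) (allFin (suc k))))
  tail = product-1mod4 k (S ∷ Rs) (λ i → Ms (Fin.suc i)) (λ i → locs (Fin.suc i)) (λ i → qs (Fin.suc i)) (λ i → hqs (Fin.suc i)) (λ i → hms (Fin.suc i))
  arith : ∀ e a b → 8 * e * (a * b) ≡ (8 * a) * (e * b)
  arith = solve-∀

to-prodF* : ∀ {k} (R : FinCommRing) (Rs : Vec FinCommRing (suc k)) →
  FinCommRing.cring R ≅ prodRing (vmap FinCommRing.cring Rs) → FinCommRing.cring R ≅ FinCommRing.cring (prodF* Rs)
to-prodF* R Rs iso = subst (FinCommRing.cring R ≅_) (≡sym (prodF*-cring Rs)) iso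

prodF*-nonzero : ∀ {k} (R₀ : FinCommRing) (Rs : Vec FinCommRing (suc k)) →
  ¬ (FinCommRing._≈_ R₀ (FinCommRing.1# R₀) (FinCommRing.0# R₀)) →
  ¬ (FinCommRing._≈_ (prodF* (R₀ ∷ Rs)) (FinCommRing.1# (prodF* (R₀ ∷ Rs))) (FinCommRing.0# (prodF* (R₀ ∷ Rs))))
prodF*-nonzero R₀ (S ∷ Rs) n e = n (proj₁ e)

n3-≅-∏ : ∀ {k} (R : FinCommRing) (Rs : Vec FinCommRing (suc k)) →
  FinCommRing.cring R ≅ prodRing (vmap FinCommRing.cring Rs) →
  ¬ (FinCommRing._≈_ R (FinCommRing.1# R) (FinCommRing.0# R)) →
  Cayley.Sq (prodF* Rs) (FinCommRing.-_ (prodF* Rs) (FinCommRing.1# (prodF* Rs))) →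
  6 * n3 R ≡ ΔQ Rs
n3-≅-∏ R Rs iso n s1 = ≡trans (Iso.n3-iso R (prodF* Rs) (to-prodF* R Rs iso) n) (Cayley.Δτ≡ΔQ (prodF* Rs) s1)

n3-≅-R₀×∏ : ∀ {k} (R' R₀ : FinCommRing) (Rs : Vec FinCommRing (suc k)) →
  FinCommRing.cring R' ≅ prodRing (FinCommRing.cring R₀ ∷ vmap FinCommRing.cring Rs) →
  ¬ (FinCommRing._≈_ R₀ (FinCommRing.1# R₀) (FinCommRing.0# R₀)) →
  Cayley.Sq (prodF* Rs) (FinCommRing.-_ (prodF* Rs) (FinCommRing.1# (prodF* Rs))) →
  6 * n3 R' ≡ Cayley.Δ R₀ (Cayley.τ R₀) * ΔQ Rs
n3-≅-R₀×∏ R' R₀ Rs iso n₀ s1 = begin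
    6 * n3 R' ≡⟨ Iso.n3-iso R' (prodF* (R₀ ∷ Rs)) iso' (Iso.1≉0← R' (prodF* (R₀ ∷ Rs)) iso' (prodF*-nonzero R₀ Rs n₀)) ⟩
    Cayley.Δ (prodF* (R₀ ∷ Rs)) (Cayley.τ (prodF* (R₀ ∷ Rs))) ≡⟨ cong (λ X → Cayley.Δ X (Cayley.τ X)) (prodF*-cons R₀ Rs) ⟩
    Cayley.Δ (prodF R₀ (prodF* Rs)) (Cayley.τ (prodF R₀ (prodF* Rs))) ≡⟨ ProdFacts.Δτ-prod R₀ (prodF* Rs) s1 ⟩
    Cayley.Δ R₀ (Cayley.τ R₀) * ΔQ Rs ∎
  where
  open Relation.Binary.PropositionalEquality.≡-Reasoning
  iso' : FinCommRing.cring R' ≅ FinCommRing.cring (prodF* (R₀ ∷ Rs))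
  iso' = to-prodF* R' (R₀ ∷ Rs) iso

corollary4p3 :
    (R₀ : FinCommRing) (M₀ : Subset R₀) → IsLocalWithMax R₀ M₀ →
    (q₀ : ℕ) → q₀ * subsetCard R₀ M₀ ≡ card R₀ → q₀ % 4 ≡ 3 →
    (k : ℕ) (Rs : Vec FinCommRing (suc k)) →
    (Ms : (i : Fin (suc k)) → Subset (lookup Rs i)) →
    (∀ i → IsLocalWithMax (lookup Rs i) (Ms i)) →
    (qs : Fin (suc k) → ℕ) →
    (∀ i → qs i * subsetCard (lookup Rs i) (Ms i) ≡ card (lookup Rs i)) →
    (∀ i j → i ≤ᶠ j → qs i ≤ qs j) →
    (∀ i → qs i % 4 ≡ 1) →
    (R : FinCommRing) → FinCommRing.cring R ≅ prodRing (vmap FinCommRing.cring Rs) →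
    ¬ (FinCommRing._≈_ R (FinCommRing.1# R) (FinCommRing.0# R)) →
    (R' : FinCommRing) → FinCommRing.cring R' ≅ prodRing (FinCommRing.cring R₀ ∷ vmap FinCommRing.cring Rs) →
    (6 * n3 R₀ ≡ subsetCard R₀ M₀ * card R₀ * unitCard R₀ * (q₀ ∸ 2))
    × (6 * 8 ^ suc k * n3 R ≡
         product (map (λ i → subsetCard (lookup Rs i) (Ms i) * card (lookup Rs i)
                               * unitCard (lookup Rs i) * (qs i ∸ 5)) (allFin (suc k))))
    × (6 * 8 ^ suc k * n3 R' ≡
         subsetCard R₀ M₀ * card R₀ * unitCard R₀ * (q₀ ∸ 2) *
         product (map (λ i → subsetCard (lookup Rs i) (Ms i) * card (lookup Rs i)
                               * unitCard (lookup Rs i) * (qs i ∸ 5)) (allFin (suc k))))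
corollary4p3 R₀ M₀ loc₀ q₀ hq₀ hm₀ k Rs Ms locs qs hqs _ hms R isoR nzR R' isoR' =
  proj₂ part-a , part-b , part-c
  where
  open Relation.Binary.PropositionalEquality.≡-Reasoning
  part-a : ¬ (FinCommRing._≈_ R₀ (FinCommRing.1# R₀) (FinCommRing.0# R₀)) × (6 * n3 R₀ ≡ weight R₀ M₀ q₀ 2)
  part-a = local-3mod4 R₀ M₀ loc₀ q₀ hq₀ hm₀
  Π : ℕ
  Π = product (map (λ i → weight (lookup Rs i) (Ms i) (qs i) 5) (allFin (suc k)))
  part-∏ : Cayley.Sq (prodF* Rs) (FinCommRing.-_ (prodF* Rs) (FinCommRing.1# (prodF* Rs))) × (8 ^ suc k * ΔQ Rs ≡ Π)
  part-∏ = product-1mod4 k Rs Ms locs qs hqs hms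
  part-b : 6 * 8 ^ suc k * n3 R ≡ Π
  part-b = begin
    6 * 8 ^ suc k * n3 R ≡⟨ arith (8 ^ suc k) (n3 R) ⟩
    8 ^ suc k * (6 * n3 R) ≡⟨ cong (8 ^ suc k *_) (n3-≅-∏ R Rs isoR nzR (proj₁ part-∏)) ⟩
    8 ^ suc k * ΔQ Rs ≡⟨ proj₂ part-∏ ⟩
    Π ∎
    where
    arith : ∀ e n → 6 * e * n ≡ e * (6 * n)
    arith = solve-∀
  part-c : 6 * 8 ^ suc k * n3 R' ≡ weight R₀ M₀ q₀ 2 * Π
  part-c = begin
    6 * 8 ^ suc k * n3 R' ≡⟨ arith (8 ^ suc k) (n3 R') ⟩
    8 ^ suc k * (6 * n3 R') ≡⟨ cong (8 ^ suc k *_) (n3-≅-R₀×∏ R' R₀ Rs isoR' (proj₁ part-a) (proj₁ part-∏)) ⟩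
    8 ^ suc k * (Cayley.Δ R₀ (Cayley.τ R₀) * ΔQ Rs) ≡⟨ arith₂ (8 ^ suc k) (Cayley.Δ R₀ (Cayley.τ R₀)) (ΔQ Rs) ⟩
    Cayley.Δ R₀ (Cayley.τ R₀) * (8 ^ suc k * ΔQ Rs) ≡⟨ cong₂ _*_ (≡trans (≡sym (Cayley.n3≡Δ R₀ (proj₁ part-a))) (proj₂ part-a)) (proj₂ part-∏) ⟩
    weight R₀ M₀ q₀ 2 * Π ∎
    where
    arith : ∀ e n → 6 * e * n ≡ e * (6 * n)
    arith = solve-∀
    arith₂ : ∀ e a b → e * (a * b) ≡ a * (e * b)
    arith₂ = solve-∀
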